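{- Let $p$ be a prime and let $r\in\mathbb{F}_p[x]$ be a monic prime self-reciprocal polynomial of even degree, and $k\ge1$ an integer. Then \[ \mathcal{G}_{n}(r^k;z)=1+\sum_{j=1}^{k}\left(p^{\frac{\deg(r^{j})}{2}}-p^{\frac{\deg(r^{j})-\deg(r)}{2}}\right)z^{j\deg(r)}. \] For an even positive integer $k$, \[ \mathcal{G}_{n}((x+1)^{k};z)=\mathcal{G}_{n}((x-1)^{k};z)=1+\sum_{j=1}^{k/2}p^{j-1}(p-1)z^{2j}. \]
   Context: For $f\in\mathbb{F}_p[x]$ with $f(0)\neq0$, the reciprocal is $f^*(x)=x^{\deg f}f(1/x)$; a nonzero polynomial $g$ is self-reciprocal if $g^*=g$. A monic $f$ is prime self-reciprocal if either $f$ is irreducible and self-reciprocal, or $f=ugg^*$ with $g$ monic irreducible, $g^*$ not a constant multiple of $g$, $u\in\mathbb{F}_p^*$. For $f\in\mathbb{F}_p[x]$ let $K(f)$ be the set of nonzero self-reciprocal $g\in\mathbb{F}_p[x]$ of even degree (nonzero constants have degree $0$) with $\deg g<\deg f$ and $\gcd(g,f)=1$, and $\phi_p(f)=|K(f)|$. For an integer $t$: $\mathcal{N}_n(f;t)=1$ if $t=0$; $\mathcal{N}_n(f;t)=\sum_d\phi_p(d)$ over all monic self-reciprocal divisors $d$ of $f$ with $\deg d=t$, if $t>0$ is even; $\mathcal{N}_n(f;t)=0$ otherwise. $\mathcal{G}_n(f;z)=\sum_{t}\mathcal{N}_n(f;t)z^t$ (a polynomial; the index $n$ plays no role). -}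

module Defs where

open import Data.Nat using (ℕ; zero; suc; _+_; _*_; _∸_; _%_; _≤_; _<_; _>_)
open import Data.Nat.Divisibility using (_∣_)
open import Data.List using (List; []; _∷_; map; foldr; reverse; length; last)
open import Data.Nat.ListAction using (sum)
open import Data.List.Membership.Propositional using (_∈_)
open import Data.List.Relation.Unary.Unique.Propositional using (Unique)
open import Data.List.Relation.Binary.Pointwise using (Pointwise)
open import Data.Maybe using (just)
open import Data.Product using (Σ; ∃; _×_)
open import Data.Sum using (_⊎_)
open import Relation.Nullary using (¬_)
open import Relation.Binary.PropositionalEquality using (_≡_; _≢_)

-- Polynomials over F_p are coefficient lists (constant term first) of
-- natural numbers; a polynomial is *canonical* if all coefficients are < p
-- and the last (leading) coefficient is nonzero. The zero polynomial is [].

-- reduction mod p (p = 0 never occurs since p is prime)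
red : ℕ → ℕ → ℕ
red zero    a = a
red (suc q) a = a % suc q

consT : ℕ → List ℕ → List ℕ
consT zero    []      = []
consT (suc a) []      = suc a ∷ []
consT a       (b ∷ g) = a ∷ b ∷ g

strip : List ℕ → List ℕ
strip = foldr consT []

norm : ℕ → List ℕ → List ℕ
norm p f = strip (map (red p) f)

Canonical : ℕ → List ℕ → Set
Canonical p f = norm p f ≡ f

addRaw : List ℕ → List ℕ → List ℕ
addRaw []      g       = g
addRaw (a ∷ f) []      = a ∷ f
addRaw (a ∷ f) (b ∷ g) = (a + b) ∷ addRaw f g

mulRaw : List ℕ → List ℕ → List ℕ
mulRaw []      g = []
mulRaw (a ∷ f) g = addRaw (map (a *_) g) (0 ∷ mulRaw f g)

mul : ℕ → List ℕ → List ℕ → List ℕ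
mul p f g = norm p (mulRaw f g)

pow : ℕ → List ℕ → ℕ → List ℕ
pow p f zero    = norm p (1 ∷ [])
pow p f (suc k) = mul p f (pow p f k)

cmul : ℕ → ℕ → List ℕ → List ℕ
cmul p c g = norm p (map (c *_) g)

deg : List ℕ → ℕ
deg f = length f ∸ 1

Monic : List ℕ → Set
Monic f = last f ≡ just 1

Divides : ℕ → List ℕ → List ℕ → Set
Divides p g f = Σ (List ℕ) λ h → Canonical p h × mul p g h ≡ f

-- nonzero constant (unit) polynomial: canonical of length 1
Irreducible : ℕ → List ℕ → Set
Irreducible p f = Canonical p f × 2 ≤ length f ×
  (∀ g h → Canonical p g → Canonical p h → mul p g h ≡ f →
     length g ≡ 1 ⊎ length h ≡ 1)

-- reciprocal f* = x^{deg f} f(1/x)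
recip : ℕ → List ℕ → List ℕ
recip p f = norm p (reverse f)

SelfRecip : ℕ → List ℕ → Set
SelfRecip p g = g ≢ [] × recip p g ≡ g

PrimeSelfRecip : ℕ → List ℕ → Set
PrimeSelfRecip p f = Canonical p f × Monic f ×
  ((Irreducible p f × SelfRecip p f) ⊎
   (Σ (List ℕ) λ g → Σ ℕ λ u →
      Monic g × Irreducible p g ×
      (¬ ∃ λ c → recip p g ≡ cmul p c g) ×
      0 < u × u < p ×
      f ≡ mul p (mul p (u ∷ []) g) (recip p g)))

Coprime : ℕ → List ℕ → List ℕ → Set
Coprime p g f = ∀ d → Canonical p d → Divides p d g → Divides p d f → length d ≡ 1

InK : ℕ → List ℕ → List ℕ → Set
InK p f g = Canonical p g × SelfRecip p g × 2 ∣ deg g × deg g < deg f × Coprime p g f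

HasCard : (List ℕ → Set) → ℕ → Set
HasCard P n = Σ (List (List ℕ)) λ L → Unique L ×
  (∀ g → g ∈ L → P g) × (∀ g → P g → g ∈ L) × length L ≡ n

Phi : ℕ → List ℕ → ℕ → Set
Phi p f n = HasCard (InK p f) n

SRDiv : ℕ → List ℕ → ℕ → List ℕ → Set
SRDiv p f t d = Canonical p d × Monic d × SelfRecip p d × Divides p d f × deg d ≡ t

-- IsN p f t n  means  𝒩_n(f; t) = n   (t ≥ 0; negative t give 0 trivially)
data IsN (p : ℕ) (f : List ℕ) : ℕ → ℕ → Set where
  N-zero : IsN p f 0 1
  N-odd  : ∀ {t} → ¬ (2 ∣ t) → IsN p f t 0
  N-even : ∀ {t n} → t > 0 → 2 ∣ t →
           (D : List (List ℕ)) → Unique D →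
           (∀ d → d ∈ D → SRDiv p f t d) → (∀ d → SRDiv p f t d → d ∈ D) →
           (ns : List ℕ) → Pointwise (Phi p) D ns → sum ns ≡ n →
           IsN p f t n

-- The monic self-reciprocal divisors of r^k of even degree are exactly the powers r^j. Indeed, if
-- a non-unit divides r^k and an even-degree self-reciprocal g, then r ∣ g: for irreducible r this is
-- Euclid's lemma, and for r = u·g₀·g₀* the factors g₀ and g₀* are swapped by reciprocation, so
-- both divide g; the cofactor g / r is again self-reciprocal of even degree. Hence 𝒩(r^k; t)
-- vanishes unless t = j·deg r, where it equals φ(r^j).
-- A self-reciprocal polynomial of even degree < 2N is the palindrome on its nonzero upper half,
-- so there are p^N − 1 of them, and those divisible by r are r·h with h of the same kind and
-- degree < 2N − deg r. Since φ(r^j) counts those of degree < j·deg r not divisible by r,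
-- φ(r^j) = p^{j·deg r/2} − p^{(j−1)·deg r/2}.
-- For (x ± 1)^k with k even, (x ± 1)² plays the rôle of r: if x ± 1 divides an even-degree
-- self-reciprocal g = (x ± 1)·h, then h* = ±h with deg h odd, which forces h(∓1) = 0.

module Submission where

open import Defs
open import Data.Nat
open import Data.Nat.Properties
open import Data.Nat.DivMod
open import Data.Nat.Divisibility using
    (_∣_; divides; m%n≡0⇒n∣m; n∣m⇒m%n≡0; ∣m+n∣m⇒∣n; ∣m∣n⇒∣m+n; ∣n⇒∣m*n; _∣?_)
open import Data.Nat.Primality using (Prime; euclidsLemma; ¬prime[0]; ¬prime[1])
open import Data.Nat.Coprimality using (prime⇒coprime; coprime-Bézout)
open import Data.Nat.GCD using (module Bézout)
open import Data.List using (List; []; _∷_; map; reverse; length; _++_; replicate; last; initLast; _∷ʳ′_; filter)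
open import Data.List.Properties using
    (map-++; length-++; length-map; length-reverse; reverse-++; reverse-involutive; length-replicate;
    unfold-reverse; ++-assoc; ++-identityʳ; reverse-map; ∷ʳ-injective; ∷-injective; ≡-dec)
open import Data.List.Membership.Propositional using (_∈_)
open import Data.List.Membership.Propositional.Properties using
    (∈-map⁺; ∈-map⁻; ∈-++⁺ˡ; ∈-++⁺ʳ; ∈-++⁻; ∈-∃++; ∈-filter⁺; ∈-filter⁻)
open import Data.List.Relation.Unary.Any using (here; there)
open import Data.List.Relation.Unary.All as All using (All)
open import Data.List.Relation.Unary.All.Properties using () renaming (map⁺ to All-map⁺)
import Data.List.Relation.Unary.AllPairs as AllPairs
open import Data.List.Relation.Unary.Unique.Propositional using (Unique)
import Data.List.Relation.Unary.Unique.Propositional.Properties as Unique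
import Data.List.Relation.Binary.Pointwise as Pointwise
open import Data.Maybe using (just)
open import Data.Product using (Σ; ∃; _×_; _,_; proj₁; proj₂)
open import Data.Sum using (_⊎_; inj₁; inj₂)
open import Data.Empty using (⊥; ⊥-elim)
open import Relation.Binary.PropositionalEquality
open import Relation.Nullary using (¬_; Dec; yes; no; ¬?)
open import Relation.Unary using (Decidable)

-- Counting

Unique-⊆⇒length≤ : ∀ {A : Set} (xs ys : List A) → Unique xs → (∀ x → x ∈ xs → x ∈ ys) →
                    length xs ≤ length ys
Unique-⊆⇒length≤ [] ys u s = z≤n
Unique-⊆⇒length≤ (x ∷ xs) ys (x∉xs AllPairs.∷ u) s with ∈-∃++ (s x (here refl))
... | us , vs , refl =
  ≤-trans (s≤s (Unique-⊆⇒length≤ xs (us ++ vs) u λ y m → drop (s y (there m))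
      (λ e → All.lookup x∉xs m (sym e))))
          (≤-reflexive (sym (trans (length-++ us)
              (trans (+-suc (length us) (length vs)) (cong suc (sym (length-++ us)))))))
  where
  drop : ∀ {y} → y ∈ us ++ x ∷ vs → y ≢ x → y ∈ us ++ vs
  drop m ne with ∈-++⁻ us m
  ... | inj₁ m' = ∈-++⁺ˡ m'
  ... | inj₂ (here e) = ⊥-elim (ne e)
  ... | inj₂ (there m') = ∈-++⁺ʳ us m'

HasCard-unique : ∀ {B : List ℕ → Set} {n m} → HasCard B n → HasCard B m → n ≡ m
HasCard-unique (L , u , s , c , l) (L' , u' , s' , c' , l') =
  trans (sym l) (trans (≤-antisym (Unique-⊆⇒length≤ L L' u (λ x m → c' x (s x m)))
                                  (Unique-⊆⇒length≤ L' L u' (λ x m → c x (s' x m)))) l')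

HasCard-⇔ : ∀ {B C : List ℕ → Set} {n} → HasCard B n → (∀ g → B g → C g) → (∀ g → C g → B g) → HasCard C n
HasCard-⇔ (L , u , s , c , l) f g = L , u , (λ x m → f x (s x m)) , (λ x m → c x (g x m)) , l

HasCard-∅ : ∀ {B : List ℕ → Set} → (∀ g → ¬ B g) → HasCard B 0
HasCard-∅ nb = [] , AllPairs.[] , (λ x ()) , (λ x b → ⊥-elim (nb x b)) , refl

HasCard-≡ : ∀ x → HasCard (_≡ x) 1
HasCard-≡ x = (x ∷ []) , (All.[] AllPairs.∷ AllPairs.[]) , (λ { y (here e) → e }) ,
    (λ { y refl → here refl }) , refl

HasCard-⊎ : ∀ {B C : List ℕ → Set} {n m} → HasCard B n → HasCard C m → (∀ g → B g → C g → ⊥) →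
            HasCard (λ g → B g ⊎ C g) (n + m)
HasCard-⊎ {B} {C} (L , u , s , c , l) (L' , u' , s' , c' , l') disjoint =
  L ++ L' , Unique.++⁺ u u' (λ { (m , m') → disjoint _ (s _ m) (s' _ m') }) ,
  (λ x m → sound x (∈-++⁻ L m)) ,
  (λ { x (inj₁ b) → ∈-++⁺ˡ (c x b) ; x (inj₂ b) → ∈-++⁺ʳ L (c' x b) }) ,
  trans (length-++ L) (cong₂ _+_ l l')
  where
  sound : ∀ x → x ∈ L ⊎ x ∈ L' → B x ⊎ C x
  sound x (inj₁ m) = inj₁ (s x m)
  sound x (inj₂ m) = inj₂ (s' x m)

length-filter+length-filter¬ : ∀ {A : Set} {B : A → Set} (B? : Decidable B) (L : List A) →
  length (filter B? L) + length (filter (λ x → ¬? (B? x)) L) ≡ length L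
length-filter+length-filter¬ B? [] = refl
length-filter+length-filter¬ B? (x ∷ L) with B? x
... | yes _ = cong suc (length-filter+length-filter¬ B? L)
... | no _ = trans (+-suc _ _) (cong suc (length-filter+length-filter¬ B? L))

HasCard-split : ∀ {B C : List ℕ → Set} {n} → HasCard B n → Decidable C →
  Σ ℕ λ n₁ → Σ ℕ λ n₂ → HasCard (λ g → B g × C g) n₁ × HasCard (λ g → B g × ¬ C g) n₂ × n₁ + n₂ ≡ n
HasCard-split {B} {C} (L , u , s , c , l) C? =
  length (filter C? L) , length (filter ¬C? L) , restrict C? , restrict ¬C? ,
  trans (length-filter+length-filter¬ C? L) l
  where
  ¬C? : Decidable (λ x → ¬ C x)
  ¬C? x = ¬? (C? x)
  restrict : ∀ {D : List ℕ → Set} (D? : Decidable D) → HasCard (λ g → B g × D g) (length (filter D? L))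
  restrict D? = filter D? L , Unique.filter⁺ D? u ,
    (λ x m → s x (proj₁ (∈-filter⁻ D? {xs = L} m)) , proj₂ (∈-filter⁻ D? {xs = L} m)) ,
    (λ x bd → ∈-filter⁺ D? (c x (proj₁ bd)) (proj₂ bd)) , refl

HasCard-image : ∀ {C : List ℕ → Set} {n} → HasCard C n → (f : List ℕ → List ℕ) →
  (∀ x y → C x → C y → f x ≡ f y → x ≡ y) → HasCard (λ g → Σ (List ℕ) λ x → C x × g ≡ f x) n
HasCard-image (L , u , s , c , l) f inj =
  map f L , unique-map L u (λ x y mx my → inj x y (s x mx) (s y my)) ,
  (λ g m → let (x , mx , e) = ∈-map⁻ f m in x , s x mx , e) ,
  (λ { g (x , cx , refl) → ∈-map⁺ f (c x cx) }) ,
  trans (length-map f L) l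
  where
  unique-map : ∀ M → Unique M → (∀ x y → x ∈ M → y ∈ M → f x ≡ f y → x ≡ y) → Unique (map f M)
  unique-map [] u inj = AllPairs.[]
  unique-map (x ∷ M) (x∉M AllPairs.∷ u) inj =
    All-map⁺ (All.tabulate λ {y} m e → All.lookup x∉M m (inj x y (here refl) (there m) e)) AllPairs.∷
    unique-map M u (λ a b ma mb → inj a b (there ma) (there mb))

PrimePowerCoefficients : ℕ → List ℕ → ℕ → Set
PrimePowerCoefficients p r k =
  IsN p (pow p r k) 0 1 ×
  (∀ j → 1 ≤ j → j ≤ k →
    IsN p (pow p r k) (j * deg r) (p ^ ⌊ deg (pow p r j) /2⌋ ∸ p ^ ⌊ (deg (pow p r j) ∸ deg r) /2⌋)) ×
  (∀ t → (∀ j → j ≤ k → t ≢ j * deg r) → IsN p (pow p r k) t 0)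

LinearPowerCoefficients : ℕ → List ℕ → ℕ → Set
LinearPowerCoefficients p f k =
  IsN p (pow p f k) 0 1 ×
  (∀ j → 1 ≤ j → j ≤ ⌊ k /2⌋ → IsN p (pow p f k) (2 * j) (p ^ (j ∸ 1) * (p ∸ 1))) ×
  (∀ t → (∀ j → j ≤ ⌊ k /2⌋ → t ≢ 2 * j) → IsN p (pow p f k) t 0)

-- Arithmetic in 𝔽ₚ[x]

module _ (q : ℕ) (isPrime : Prime (suc (suc q))) where

  p : ℕ
  p = suc (suc q)

  consT-injective : ∀ {a b u v} → consT a u ≡ consT b v → a ≡ b × u ≡ v
  consT-injective {zero} {zero} {[]} {[]} e = refl , refl
  consT-injective {suc a} {suc b} {[]} {[]} refl = refl , refl
  consT-injective {zero} {zero} {x ∷ u} {y ∷ v} refl = refl , refl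
  consT-injective {zero} {suc b} {x ∷ u} {y ∷ v} ()
  consT-injective {suc a} {zero} {x ∷ u} {y ∷ v} ()
  consT-injective {suc a} {suc b} {x ∷ u} {y ∷ v} refl = refl , refl
  consT-injective {zero} {suc b} {[]} {[]} ()
  consT-injective {suc a} {zero} {[]} {[]} ()
  consT-injective {zero} {zero} {[]} {x ∷ v} ()
  consT-injective {zero} {suc b} {[]} {x ∷ v} ()
  consT-injective {suc a} {zero} {[]} {x ∷ v} ()
  consT-injective {suc a} {suc b} {[]} {x ∷ v} ()
  consT-injective {zero} {zero} {x ∷ u} {[]} ()
  consT-injective {suc a} {zero} {x ∷ u} {[]} ()
  consT-injective {zero} {suc b} {x ∷ u} {[]} ()
  consT-injective {suc a} {suc b} {x ∷ u} {[]} ()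

  consT-view : ∀ x u → (consT x u ≡ x ∷ u) ⊎ (x ≡ 0 × u ≡ [])
  consT-view zero [] = inj₂ (refl , refl)
  consT-view (suc x) [] = inj₁ refl
  consT-view zero (y ∷ u) = inj₁ refl
  consT-view (suc x) (y ∷ u) = inj₁ refl

  norm-consT : ∀ a u → norm p (consT a u) ≡ consT (a % p) (norm p u)
  norm-consT zero [] = refl
  norm-consT (suc a) [] = refl
  norm-consT zero (x ∷ u) = refl
  norm-consT (suc a) (x ∷ u) = refl

  norm-idem : ∀ f → norm p (norm p f) ≡ norm p f
  norm-idem [] = refl
  norm-idem (a ∷ f) = trans (norm-consT (a % p) (norm p f)) (cong₂ consT (m%n%n≡m%n a p) (norm-idem f))

  -- Raw coefficient lists (entries unreduced, trailing zeros allowed) denote the same element of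
  -- 𝔽ₚ[x] when they normalise to the same canonical list.
  infix 4 _≈_
  record _≈_ (f g : List ℕ) : Set where
    constructor mk
    field un : norm p f ≡ norm p g
  open _≈_ public

  ≈-refl : ∀ {f} → f ≈ f
  ≈-refl = mk refl
  ≈-sym : ∀ {f g} → f ≈ g → g ≈ f
  ≈-sym (mk e) = mk (sym e)
  infixr 5 _∙_
  _∙_ : ∀ {f g h} → f ≈ g → g ≈ h → f ≈ h
  mk e ∙ mk e' = mk (trans e e')
  ≡→≈ : ∀ {f g} → f ≡ g → f ≈ g
  ≡→≈ refl = ≈-refl

  IsZero : List ℕ → Set
  IsZero f = f ≈ []

  ≈-∷ : ∀ {a b f g} → a % p ≡ b % p → f ≈ g → (a ∷ f) ≈ (b ∷ g)
  ≈-∷ e1 (mk e2) = mk (cong₂ consT e1 e2)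

  ≈-∷⁻¹ : ∀ {a b f g} → (a ∷ f) ≈ (b ∷ g) → a % p ≡ b % p × f ≈ g
  ≈-∷⁻¹ (mk e) = proj₁ (consT-injective e) , mk (proj₂ (consT-injective e))

  IsZero-∷ : ∀ {a f} → a % p ≡ 0 → IsZero f → IsZero (a ∷ f)
  IsZero-∷ e1 (mk e2) = mk (cong₂ consT e1 e2)

  norm≈ : ∀ f → norm p f ≈ f
  norm≈ f = mk (norm-idem f)

  add-identityʳ : ∀ f → addRaw f [] ≡ f
  add-identityʳ [] = refl
  add-identityʳ (a ∷ f) = refl

  add-comm : ∀ f g → addRaw f g ≡ addRaw g f
  add-comm [] g = sym (add-identityʳ g)
  add-comm (a ∷ f) [] = refl
  add-comm (a ∷ f) (b ∷ g) = cong₂ _∷_ (+-comm a b) (add-comm f g)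

  add-assoc : ∀ f g h → addRaw (addRaw f g) h ≡ addRaw f (addRaw g h)
  add-assoc [] g h = refl
  add-assoc (a ∷ f) [] h = refl
  add-assoc (a ∷ f) (b ∷ g) [] = refl
  add-assoc (a ∷ f) (b ∷ g) (c ∷ h) = cong₂ _∷_ (+-assoc a b c) (add-assoc f g h)

  add-left-comm : ∀ f g h → addRaw f (addRaw g h) ≡ addRaw g (addRaw f h)
  add-left-comm f g h = trans (sym (add-assoc f g h))
      (trans (cong (λ z → addRaw z h) (add-comm f g)) (add-assoc g f h))

  add-interchange : ∀ a b c d → addRaw (addRaw a b) (addRaw c d) ≡ addRaw (addRaw a c) (addRaw b d)
  add-interchange a b c d = trans (add-assoc a b (addRaw c d))
      (trans (cong (addRaw a) (add-left-comm b c d)) (sym (add-assoc a c (addRaw b d))))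

  %-+-absorbˡ : ∀ a b → (a + b) % p ≡ (a % p + b) % p
  %-+-absorbˡ a b = trans (%-distribˡ-+ a b p)
      (trans (cong (λ z → (z + b % p) % p) (sym (m%n%n≡m%n a p))) (sym (%-distribˡ-+ (a % p) b p)))

  %-+-absorbʳ : ∀ a b → (a + b) % p ≡ (a + b % p) % p
  %-+-absorbʳ a b = trans (cong (_% p) (+-comm a b))
      (trans (%-+-absorbˡ b a) (cong (_% p) (+-comm (b % p) a)))

  norm-add-normˡ : ∀ f g → norm p (addRaw f g) ≡ norm p (addRaw (norm p f) g)
  norm-add-normˡ [] g = refl
  norm-add-normˡ (a ∷ f) [] rewrite add-identityʳ (norm p (a ∷ f)) = sym (norm-idem (a ∷ f))
  norm-add-normˡ (a ∷ f) (b ∷ g) with consT-view (a % p) (norm p f)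
  ... | inj₁ e rewrite e = cong₂ consT (%-+-absorbˡ a b) (norm-add-normˡ f g)
  ... | inj₂ (e1 , e2) rewrite e1 | e2 =
      cong₂ consT (trans (%-+-absorbˡ a b) (cong (λ z → (z + b) % p) e1))
      (trans (norm-add-normˡ f g) (cong (λ z → norm p (addRaw z g)) e2))

  add-normˡ : ∀ f g → addRaw f g ≈ addRaw (norm p f) g
  add-normˡ f g = mk (norm-add-normˡ f g)

  cong-≈ : ∀ (F : List ℕ → List ℕ) {f g} → f ≡ g → F f ≈ F g
  cong-≈ F refl = ≈-refl

  resp-≈-via-norm : ∀ (F : List ℕ → List ℕ) → (∀ f → F f ≈ F (norm p f)) → ∀ {f g} → f ≈ g → F f ≈ F g
  resp-≈-via-norm F h {f} {g} (mk e) = h f ∙ cong-≈ F e ∙ ≈-sym (h g)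

  add-cong : ∀ {f f' g g'} → f ≈ f' → g ≈ g' → addRaw f g ≈ addRaw f' g'
  add-cong {f} {f'} {g} {g'} e1 e2 =
    resp-≈-via-norm (λ z → addRaw z g) (λ z → add-normˡ z g) e1 ∙ ≡→≈ (add-comm f' g) ∙
    resp-≈-via-norm (λ z → addRaw z f') (λ z → add-normˡ z f') e2 ∙ ≡→≈ (add-comm g' f')

  scale : ℕ → List ℕ → List ℕ
  scale c f = map (c *_) f

  norm-scale-norm : ∀ c f → norm p (scale c f) ≡ norm p (scale (c % p) (norm p f))
  norm-scale-norm c [] = refl
  norm-scale-norm c (a ∷ f) with consT-view (a % p) (norm p f)
  ... | inj₁ e rewrite e = cong₂ consT
      (trans (%-distribˡ-* c a p) (sym
      (trans (%-distribˡ-* (c % p) (a % p) p) (cong₂ (λ x y → (x * y) % p) (m%n%n≡m%n c p) (m%n%n≡m%n a p)))))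
      (norm-scale-norm c f)
  ... | inj₂ (e1 , e2) rewrite e1 | e2 =
      un (IsZero-∷ {c * a} {scale c f}
      (trans (%-distribˡ-* c a p) (trans (cong (λ z → (c % p * z) % p) e1) (cong (_% p) (*-zeroʳ (c % p)))))
      (mk (trans (norm-scale-norm c f) (cong (λ z → norm p (scale (c % p) z)) e2))))

  scale-cong : ∀ {c d f g} → c % p ≡ d % p → f ≈ g → scale c f ≈ scale d g
  scale-cong {c} {d} {f} {g} e1 (mk e2) =
      mk (trans (norm-scale-norm c f)
      (trans (cong₂ (λ x y → norm p (scale x y)) e1 e2) (sym (norm-scale-norm d g))))

  IsZero-scale0 : ∀ f → IsZero (scale 0 f)
  IsZero-scale0 [] = ≈-refl
  IsZero-scale0 (a ∷ f) = IsZero-∷ {0} {scale 0 f} refl (IsZero-scale0 f)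

  IsZero-add : ∀ {f g} → IsZero f → IsZero g → IsZero (addRaw f g)
  IsZero-add e1 e2 = add-cong e1 e2

  mul-normˡ : ∀ f g → mulRaw f g ≈ mulRaw (norm p f) g
  mul-normˡ [] g = ≈-refl
  mul-normˡ (a ∷ f) g with consT-view (a % p) (norm p f)
  ... | inj₁ e rewrite e = add-cong (scale-cong {a} {a % p} (sym (m%n%n≡m%n a p)) ≈-refl)
      (≈-∷ {0} {0} refl (mul-normˡ f g))
  ... | inj₂ (e1 , e2) rewrite e1 | e2 =
      IsZero-add {scale a g} {0 ∷ mulRaw f g} (scale-cong {a} {0} {g} {g} e1 ≈-refl ∙ IsZero-scale0 g)
      (IsZero-∷ {0} {mulRaw f g} refl (mul-normˡ f g ∙ cong-≈ (λ z → mulRaw z g) e2))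

  mul-normʳ : ∀ f g → mulRaw f g ≈ mulRaw f (norm p g)
  mul-normʳ [] g = ≈-refl
  mul-normʳ (a ∷ f) g = add-cong (scale-cong {a} {a} refl (≈-sym (norm≈ g)))
      (≈-∷ {0} {0} refl (mul-normʳ f g))

  mul-cong : ∀ {f f' g g'} → f ≈ f' → g ≈ g' → mulRaw f g ≈ mulRaw f' g'
  mul-cong {f} {f'} {g} {g'} e1 e2 = resp-≈-via-norm (λ z → mulRaw z g) (λ z → mul-normˡ z g) e1
      ∙ resp-≈-via-norm (mulRaw f') (mul-normʳ f') e2

  IsZero-mul[] : ∀ f → IsZero (mulRaw f [])
  IsZero-mul[] [] = ≈-refl
  IsZero-mul[] (a ∷ f) = IsZero-∷ {0} {mulRaw f []} refl (IsZero-mul[] f)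

  mul-∷ʳ : ∀ f b g → mulRaw f (b ∷ g) ≈ addRaw (scale b f) (0 ∷ mulRaw f g)
  mul-∷ʳ [] b g = mk refl
  mul-∷ʳ (a ∷ f) b g = ≈-∷ {a * b + 0} {b * a + 0} (cong (λ z → (z + 0) % p) (*-comm a b))
    (add-cong {scale a g} {scale a g} ≈-refl (mul-∷ʳ f b g)
        ∙ ≡→≈ (add-left-comm (scale a g) (scale b f) (0 ∷ mulRaw f g)))

  mul-comm : ∀ f g → mulRaw f g ≈ mulRaw g f
  mul-comm [] g = ≈-sym (IsZero-mul[] g)
  mul-comm (a ∷ f) g = add-cong {scale a g} {scale a g} ≈-refl (≈-∷ {0} {0} refl (mul-comm f g))
      ∙ ≈-sym (mul-∷ʳ g a f)

  scale-add : ∀ c f g → scale c (addRaw f g) ≡ addRaw (scale c f) (scale c g)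
  scale-add c [] g = refl
  scale-add c (a ∷ f) [] = refl
  scale-add c (a ∷ f) (b ∷ g) = cong₂ _∷_ (*-distribˡ-+ c a b) (scale-add c f g)

  scale-scale : ∀ c d f → scale c (scale d f) ≡ scale (c * d) f
  scale-scale c d [] = refl
  scale-scale c d (a ∷ f) = cong₂ _∷_ (sym (*-assoc c d a)) (scale-scale c d f)

  mul-scaleˡ : ∀ c f g → mulRaw (scale c f) g ≈ scale c (mulRaw f g)
  mul-scaleˡ c [] g = ≈-refl
  mul-scaleˡ c (a ∷ f) g = add-cong {scale (c * a) g} {scale c (scale a g)} (≡→≈ (sym (scale-scale c a g)))
      (≈-∷ {0} {c * 0} (cong (_% p) (sym (*-zeroʳ c))) (mul-scaleˡ c f g))
      ∙ ≡→≈ (sym (scale-add c (scale a g) (0 ∷ mulRaw f g)))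

  mul-distribʳ : ∀ f g h → mulRaw f (addRaw g h) ≈ addRaw (mulRaw f g) (mulRaw f h)
  mul-distribʳ [] g h = ≈-refl
  mul-distribʳ (a ∷ f) g h = add-cong {scale a (addRaw g h)} {addRaw (scale a g) (scale a h)}
      (≡→≈ (scale-add a g h)) (≈-∷ {0} {0} refl (mul-distribʳ f g h))
    ∙ ≡→≈ (add-interchange (scale a g) (scale a h) (0 ∷ mulRaw f g) (0 ∷ mulRaw f h))

  mul-distribˡ : ∀ f g h → mulRaw (addRaw f g) h ≈ addRaw (mulRaw f h) (mulRaw g h)
  mul-distribˡ f g h = mul-comm (addRaw f g) h ∙ mul-distribʳ h f g ∙ add-cong (mul-comm h f) (mul-comm h g)

  mul-assoc : ∀ f g h → mulRaw (mulRaw f g) h ≈ mulRaw f (mulRaw g h)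
  mul-assoc [] g h = ≈-refl
  mul-assoc (a ∷ f) g h = mul-distribˡ (scale a g) (0 ∷ mulRaw f g) h ∙ add-cong (mul-scaleˡ a g h)
     (add-cong {scale 0 h} {[]} (IsZero-scale0 h) (≈-∷ {0} {0} refl (mul-assoc f g h)))

  scale-one : ∀ f → scale 1 f ≡ f
  scale-one [] = refl
  scale-one (a ∷ f) = cong₂ _∷_ (+-identityʳ a) (scale-one f)

  add-[0] : ∀ g → addRaw g (0 ∷ []) ≈ g
  add-[0] [] = mk refl
  add-[0] (b ∷ g) rewrite add-identityʳ g = ≡→≈ (cong (λ z → z ∷ g) (+-identityʳ b))

  mul-identityˡ : ∀ g → mulRaw (1 ∷ []) g ≈ g
  mul-identityˡ g = cong-≈ (λ z → addRaw z (0 ∷ [])) (scale-one g) ∙ add-[0] g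

  ++-∷-≢[] : ∀ (xs : List ℕ) d ys → xs ++ d ∷ ys ≢ []
  ++-∷-≢[] [] d ys ()
  ++-∷-≢[] (x ∷ xs) d ys ()

  consT-ne : ∀ x v → v ≢ [] → consT x v ≡ x ∷ v
  consT-ne x [] ne = ⊥-elim (ne refl)
  consT-ne zero (y ∷ v) ne = refl
  consT-ne (suc x) (y ∷ v) ne = refl

  strip-snoc : ∀ xs d → d ≢ 0 → strip (xs ++ d ∷ []) ≡ xs ++ d ∷ []
  strip-snoc [] zero ne = ⊥-elim (ne refl)
  strip-snoc [] (suc d) ne = refl
  strip-snoc (x ∷ xs) d ne rewrite strip-snoc xs d ne = consT-ne x (xs ++ d ∷ []) (++-∷-≢[] xs d [])

  strip-snoc0 : ∀ xs → strip (xs ++ 0 ∷ []) ≡ strip xs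
  strip-snoc0 [] = refl
  strip-snoc0 (x ∷ xs) = cong (consT x) (strip-snoc0 xs)

  norm-snoc : ∀ u c → c % p ≢ 0 → norm p (u ++ c ∷ []) ≡ map (red p) u ++ (c % p) ∷ []
  norm-snoc u c ne rewrite map-++ (red p) u (c ∷ []) = strip-snoc (map (red p) u) (c % p) ne

  snoc0-≈ : ∀ u c → c % p ≡ 0 → (u ++ c ∷ []) ≈ u
  snoc0-≈ u c e = mk (trans (cong strip
      (trans (map-++ (red p) u (c ∷ [])) (cong (λ z → map (red p) u ++ z ∷ []) e)))
      (strip-snoc0 (map (red p) u)))

  length-consT : ∀ x v → length (consT x v) ≤ suc (length v)
  length-consT zero [] = z≤n
  length-consT (suc x) [] = ≤-refl
  length-consT zero (y ∷ v) = ≤-refl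
  length-consT (suc x) (y ∷ v) = ≤-refl

  length-strip : ∀ xs → length (strip xs) ≤ length xs
  length-strip [] = z≤n
  length-strip (x ∷ xs) = ≤-trans (length-consT x (strip xs)) (s≤s (length-strip xs))

  length-norm : ∀ f → length (norm p f) ≤ length f
  length-norm f = ≤-trans (length-strip (map (red p) f)) (≤-reflexive (length-map (red p) f))

  -- 1 + degree, and 0 for the zero polynomial.
  ∥_∥ : List ℕ → ℕ
  ∥ f ∥ = length (norm p f)

  ∥∥-cong : ∀ {f g} → f ≈ g → ∥ f ∥ ≡ ∥ g ∥
  ∥∥-cong (mk e) = cong length e

  canonical⇒last≢0 : ∀ u a → norm p (u ++ a ∷ []) ≡ u ++ a ∷ [] → a % p ≢ 0
  canonical⇒last≢0 u a e e0 = <-irrefl refl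
      (subst (_≤ length u) (+-comm (length u) 1) (≤-trans (≤-reflexive h1) h2))
    where
    h1 : length u + 1 ≡ length (norm p (u ++ a ∷ []))
    h1 = sym (trans (cong length e) (length-++ u))
    h2 : length (norm p (u ++ a ∷ [])) ≤ length u
    h2 = ≤-trans (≤-reflexive (cong length (un (snoc0-≈ u a e0)))) (length-norm u)

  canonical-snoc-view : ∀ g → norm p g ≡ g → g ≢ [] → Σ (List ℕ) λ u → Σ ℕ λ a → g ≡ u ++ a ∷ [] × a % p ≢ 0
  canonical-snoc-view g e ne with initLast g
  ... | [] = ⊥-elim (ne refl)
  ... | u ∷ʳ′ a = u , a , refl , canonical⇒last≢0 u a e

  norm-snoc-view : ∀ f → ¬ IsZero f → Σ (List ℕ) λ u → Σ ℕ λ a → norm p f ≡ u ++ a ∷ [] × a % p ≢ 0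
  norm-snoc-view f nz = canonical-snoc-view (norm p f) (norm-idem f) (λ e → nz (mk e))

  length-add-longerʳ : ∀ y z → length y ≤ length z → length (addRaw y z) ≡ length z
  length-add-longerʳ [] z le = refl
  length-add-longerʳ (a ∷ y) (b ∷ z) (s≤s le) = cong suc (length-add-longerʳ y z le)

  add-snocʳ : ∀ y z c → length y ≤ length z → addRaw y (z ++ c ∷ []) ≡ addRaw y z ++ c ∷ []
  add-snocʳ [] z c le = refl
  add-snocʳ (a ∷ y) (b ∷ z) c (s≤s le) = cong (a + b ∷_) (add-snocʳ y z c le)

  mul-snoc-snoc : ∀ u a v b → Σ (List ℕ) λ w → (mulRaw (u ++ a ∷ []) (v ++ b ∷ []) ≈ w ++ (a * b) ∷ []) ×
      length w ≡ length u + length v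
  mul-snoc-snoc [] a v b = scale a v , add-[0] (scale a (v ++ b ∷ [])) ∙ ≡→≈ (map-++ (a *_) v (b ∷ [])) ,
      length-map (a *_) v
  mul-snoc-snoc (x ∷ u) a v b with mul-snoc-snoc u a v b
  ... | w' , e' , len' = addRaw (scale x (v ++ b ∷ [])) (0 ∷ w') ,
        add-cong {scale x (v ++ b ∷ [])} ≈-refl (≈-∷ {0} {0} refl e')
            ∙ ≡→≈ (add-snocʳ (scale x (v ++ b ∷ [])) (0 ∷ w') (a * b) le) ,
        trans (length-add-longerʳ (scale x (v ++ b ∷ [])) (0 ∷ w') le) (cong suc len')
    where
    le : length (scale x (v ++ b ∷ [])) ≤ length (0 ∷ w')
    le = ≤-trans (≤-reflexive (trans (length-map (x *_) (v ++ b ∷ []))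
        (trans (length-++ v) (+-comm (length v) 1))))
        (s≤s (≤-trans (m≤n+m (length v) (length u)) (≤-reflexive (sym len'))))

  %-*-nonzero : ∀ {a b} → a % p ≢ 0 → b % p ≢ 0 → (a * b) % p ≢ 0
  %-*-nonzero {a} {b} na nb e with euclidsLemma a b isPrime (m%n≡0⇒n∣m (a * b) p e)
  ... | inj₁ h = na (n∣m⇒m%n≡0 a p h)
  ... | inj₂ h = nb (n∣m⇒m%n≡0 b p h)

  leading-mul : ∀ f g u a v b → norm p f ≡ u ++ a ∷ [] → norm p g ≡ v ++ b ∷ [] → a % p ≢ 0 → b % p ≢ 0 →
    Σ (List ℕ) λ w → norm p (mulRaw f g) ≡ w ++ ((a * b) % p) ∷ [] × length w ≡ length u + length v
  leading-mul f g u a v b ef eg na nb with mul-snoc-snoc u a v b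
  ... | w , e , len = map (red p) w ,
      trans (un (mul-normˡ f g ∙ mul-normʳ (norm p f) g ∙ cong-≈ (λ z → mulRaw z (norm p g)) ef
      ∙ cong-≈ (mulRaw (u ++ a ∷ [])) eg ∙ e)) (norm-snoc w (a * b) (%-*-nonzero {a} {b} na nb)) ,
      trans (length-map (red p) w) len

  IsZero⇒∥∥≡0 : ∀ {f} → IsZero f → ∥ f ∥ ≡ 0
  IsZero⇒∥∥≡0 (mk e) = cong length e

  ∥∥≡0⇒IsZero : ∀ f → ∥ f ∥ ≡ 0 → IsZero f
  ∥∥≡0⇒IsZero f e = mk (len0 (norm p f) e)
    where
    len0 : ∀ (l : List ℕ) → length l ≡ 0 → l ≡ []
    len0 [] _ = refl

  IsZero? : ∀ f → Dec (IsZero f)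
  IsZero? f = helper (norm p f) refl
    where
    helper : ∀ l → norm p f ≡ l → Dec (IsZero f)
    helper [] eq = yes (mk eq)
    helper (x ∷ xs) eq = no (λ { (mk e) → case' (trans (sym eq) e) })
      where
      case' : ∀ {x : ℕ} {xs} → x ∷ xs ≡ [] → ⊥
      case' ()

  ∥∥-mul : ∀ f g → ¬ IsZero f → ¬ IsZero g → suc ∥ mulRaw f g ∥ ≡ ∥ f ∥ + ∥ g ∥
  ∥∥-mul f g nf ng with norm-snoc-view f nf | norm-snoc-view g ng
  ... | u , a , ef , na | v , b , eg , nb with leading-mul f g u a v b ef eg na nb
  ... | w , e , len = trans (cong suc
      (trans (cong length e) (trans (length-++ w) (trans (+-comm (length w) 1) (cong suc len)))))
     (trans (cong suc (sym (+-suc (length u) (length v))))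
     (sym (cong₂ _+_ (trans (cong length ef) (trans (length-++ u) (+-comm (length u) 1)))
         (trans (cong length eg) (trans (length-++ v) (+-comm (length v) 1))))))

  ∥∥-pos : ∀ f → ¬ IsZero f → 1 ≤ ∥ f ∥
  ∥∥-pos f nf = helper ∥ f ∥ refl
    where
    helper : ∀ n → ∥ f ∥ ≡ n → 1 ≤ ∥ f ∥
    helper zero e = ⊥-elim (nf (∥∥≡0⇒IsZero f e))
    helper (suc n) e = subst (1 ≤_) (sym e) (s≤s z≤n)

  mul-≉0 : ∀ f g → ¬ IsZero f → ¬ IsZero g → ¬ IsZero (mulRaw f g)
  mul-≉0 f g nf ng z = <-irrefl refl
      (≤-trans (+-mono-≤ (∥∥-pos f nf) (∥∥-pos g ng))
      (≤-reflexive (trans (sym (∥∥-mul f g nf ng)) (cong suc (IsZero⇒∥∥≡0 z)))))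

  IsZero-mul⁻¹ : ∀ f g → IsZero (mulRaw f g) → IsZero f ⊎ IsZero g
  IsZero-mul⁻¹ f g z with IsZero? f | IsZero? g
  ... | yes a | _ = inj₁ a
  ... | no a | yes b = inj₂ b
  ... | no a | no b = ⊥-elim (mul-≉0 f g a b z)

  IsZero-mulˡ : ∀ f g → IsZero f → IsZero (mulRaw f g)
  IsZero-mulˡ f g z = mul-cong z ≈-refl

  IsZero-mulʳ : ∀ f g → IsZero g → IsZero (mulRaw f g)
  IsZero-mulʳ f g z = mul-cong {f} {f} ≈-refl z ∙ IsZero-mul[] f

  -- Scaling by p − 1 ≡ −1.
  neg : List ℕ → List ℕ
  neg = scale (suc q)

  IsZero-add-neg : ∀ f → IsZero (addRaw f (neg f))
  IsZero-add-neg [] = ≈-refl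
  IsZero-add-neg (a ∷ f) = IsZero-∷ {a + suc q * a} {addRaw f (neg f)}
      (trans (cong (_% p) (*-comm p a)) (m*n%n≡0 a p)) (IsZero-add-neg f)

  IsZero-neg-add : ∀ f → IsZero (addRaw (neg f) f)
  IsZero-neg-add f = ≡→≈ (add-comm (neg f) f) ∙ IsZero-add-neg f

  add-IsZeroˡ : ∀ {f g} → IsZero f → addRaw f g ≈ g
  add-IsZeroˡ z = add-cong z ≈-refl

  add-IsZeroʳ : ∀ {f g} → IsZero g → addRaw f g ≈ f
  add-IsZeroʳ {f} z = add-cong {f} ≈-refl z ∙ ≡→≈ (add-identityʳ f)

  mul-scaleʳ : ∀ c f g → mulRaw f (scale c g) ≈ scale c (mulRaw f g)
  mul-scaleʳ c f g = mul-comm f (scale c g) ∙ mul-scaleˡ c g f ∙ scale-cong {c} {c} refl (mul-comm g f)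

  IsZero-sub⇒≈ : ∀ g h → IsZero (addRaw g (neg h)) → g ≈ h
  IsZero-sub⇒≈ g h z = ≈-sym (add-IsZeroʳ {g} (IsZero-neg-add h))
      ∙ ≡→≈ (sym (add-assoc g (neg h) h)) ∙ add-IsZeroˡ z

  mul-sub-distribˡ : ∀ f g h → mulRaw f (addRaw g (neg h)) ≈ addRaw (mulRaw f g) (neg (mulRaw f h))
  mul-sub-distribˡ f g h = mul-distribʳ f g (neg h) ∙ add-cong {mulRaw f g} ≈-refl (mul-scaleʳ (suc q) f h)

  mul-cancelˡ : ∀ f g h → ¬ IsZero f → mulRaw f g ≈ mulRaw f h → g ≈ h
  mul-cancelˡ f g h nf e with IsZero-mul⁻¹ f (addRaw g (neg h))
      (mul-sub-distribˡ f g h ∙ add-cong e (≈-refl {neg (mulRaw f h)}) ∙ IsZero-add-neg (mulRaw f h))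
  ... | inj₁ z = ⊥-elim (nf z)
  ... | inj₂ z = IsZero-sub⇒≈ g h z

  infix 4 _∣ₚ_
  _∣ₚ_ : List ℕ → List ℕ → Set
  a ∣ₚ b = Σ (List ℕ) λ h → mulRaw a h ≈ b

  ∣ₚ-refl : ∀ a → a ∣ₚ a
  ∣ₚ-refl a = (1 ∷ []) , mul-comm a (1 ∷ []) ∙ mul-identityˡ a

  ∣ₚ-respʳ : ∀ {a b b'} → b ≈ b' → a ∣ₚ b → a ∣ₚ b'
  ∣ₚ-respʳ e (h , e') = h , e' ∙ e

  ∣ₚ-trans : ∀ {a b c} → a ∣ₚ b → b ∣ₚ c → a ∣ₚ c
  ∣ₚ-trans {a} {b} {c} (h , e) (h' , e') = mulRaw h h' , ≈-sym (mul-assoc a h h')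
      ∙ mul-cong e (≈-refl {h'}) ∙ e'

  ∣ₚ-mulʳ : ∀ {a b} c → a ∣ₚ b → a ∣ₚ mulRaw b c
  ∣ₚ-mulʳ {a} {b} c (h , e) = mulRaw h c , ≈-sym (mul-assoc a h c) ∙ mul-cong e (≈-refl {c})

  ∣ₚ-mulˡ : ∀ {a b} c → a ∣ₚ b → a ∣ₚ mulRaw c b
  ∣ₚ-mulˡ {a} {b} c d = ∣ₚ-respʳ {a} (mul-comm b c) (∣ₚ-mulʳ {a} c d)

  ∣ₚ-mul : ∀ a c → a ∣ₚ mulRaw a c
  ∣ₚ-mul a c = c , ≈-refl

  ∣ₚ-add : ∀ {a b c} → a ∣ₚ b → a ∣ₚ c → a ∣ₚ addRaw b c
  ∣ₚ-add {a} (h , e) (h' , e') = addRaw h h' , mul-distribʳ a h h' ∙ add-cong e e'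

  ∣ₚ-scale : ∀ {a b} c → a ∣ₚ b → a ∣ₚ scale c b
  ∣ₚ-scale {a} c (h , e) = scale c h , mul-scaleʳ c a h ∙ scale-cong {c} {c} refl e

  %-inverse : ∀ c → c % p ≢ 0 → Σ ℕ λ d → (d * c) % p ≡ 1
  %-inverse c nc with coprime-Bézout (prime⇒coprime {n = c % p} isPrime {{≢-nonZero nc}} (m%n<n c p))
  ... | Bézout.-+ x y eq = y , trans (%-distribˡ-* y c p)
      (trans (cong (λ z → (y % p * z) % p) (sym (m%n%n≡m%n c p)))
      (trans (sym (%-distribˡ-* y (c % p) p))
      (trans (cong (_% p) (sym eq)) (trans (%-+-absorbʳ 1 (x * p))
      (cong (λ z → (1 + z) % p) (m*n%n≡0 x p))))))
  ... | Bézout.+- x y eq = suc q * y , goal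
    where
    c' = c % p
    a = suc q * y * c'
    e1 : a + suc q ≡ suc q * x * p
    e1 = begin
       suc q * y * c' + suc q ≡⟨ cong (_+ suc q) (*-assoc (suc q) y c') ⟩
       suc q * (y * c') + suc q ≡⟨ cong (suc q * (y * c') +_) (sym (*-identityʳ (suc q))) ⟩
       suc q * (y * c') + suc q * 1 ≡⟨ sym (*-distribˡ-+ (suc q) (y * c') 1) ⟩
       suc q * (y * c' + 1) ≡⟨ cong (suc q *_) (trans (+-comm (y * c') 1) eq) ⟩
       suc q * (x * p) ≡⟨ sym (*-assoc (suc q) x p) ⟩
       suc q * x * p ∎
      where open ≡-Reasoning
    e2 : (a + p) % p ≡ 1
    e2 = begin
      (a + p) % p ≡⟨ cong (_% p) (+-suc a (suc q)) ⟩
      suc (a + suc q) % p ≡⟨ %-+-absorbʳ 1 (a + suc q) ⟩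
      (1 + (a + suc q) % p) % p ≡⟨ cong (λ z → (1 + z) % p) (trans (cong (_% p) e1) (m*n%n≡0 (suc q * x) p)) ⟩
      1 ∎
      where open ≡-Reasoning
    goal : (suc q * y * c) % p ≡ 1
    goal = trans (%-distribˡ-* (suc q * y) c p)
        (trans (cong (λ z → ((suc q * y) % p * z) % p) (sym (m%n%n≡m%n c p)))
        (trans (sym (%-distribˡ-* (suc q * y) c' p)) (trans (sym ([m+n]%n≡m%n a p)) e2)))

  add-snoc-snoc : ∀ v w c d → length v ≡ length w
      → addRaw (v ++ c ∷ []) (w ++ d ∷ []) ≡ addRaw v w ++ (c + d) ∷ []
  add-snoc-snoc [] [] c d e = refl
  add-snoc-snoc (a ∷ v) (b ∷ w) c d e = cong (a + b ∷_) (add-snoc-snoc v w c d (suc-injective e))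

  length-addRaw≤ : ∀ y z → length (addRaw y z) ≤ length y ⊔ length z
  length-addRaw≤ [] z = ≤-refl
  length-addRaw≤ (a ∷ y) [] = ≤-refl
  length-addRaw≤ (a ∷ y) (b ∷ z) = s≤s (length-addRaw≤ y z)

  ∥∥≤len : ∀ f → ∥ f ∥ ≤ length f
  ∥∥≤len f = length-norm f

  -- Division and Euclid's lemma

  DivisionBy : List ℕ → List ℕ → Set
  DivisionBy u f = Σ (List ℕ) λ Q → Σ (List ℕ) λ R → (f ≈ addRaw (mulRaw (u ++ 1 ∷ []) Q) R)
      × ∥ R ∥ ≤ length u

  add-swapʳ : ∀ f g h → addRaw (addRaw f g) h ≡ addRaw (addRaw f h) g
  add-swapʳ f g h = trans (add-assoc f g h) (trans (cong (addRaw f) (add-comm g h)) (sym (add-assoc f h g)))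

  -- One step of long division: subtract c·xᵏ·m, where c is the leading coefficient of f.
  reduce-leading : ∀ u f → length u < ∥ f ∥ →
    Σ (List ℕ) λ t → Σ (List ℕ) λ f₁ → f ≈ addRaw f₁ (mulRaw (u ++ 1 ∷ []) t) × ∥ f₁ ∥ < ∥ f ∥
  reduce-leading u f u<f = t , f₁ , f≈ , f₁<f
    where
    m = u ++ 1 ∷ []
    nf : ¬ IsZero f
    nf z = <⇒≱ u<f (≤-trans (≤-reflexive (IsZero⇒∥∥≡0 z)) z≤n)
    view = norm-snoc-view f nf
    v = proj₁ view
    c = proj₁ (proj₂ view)
    ef : norm p f ≡ v ++ c ∷ []
    ef = proj₁ (proj₂ (proj₂ view))
    ∥f∥ : ∥ f ∥ ≡ suc (length v)
    ∥f∥ = trans (cong length ef) (trans (length-++ v) (+-comm (length v) 1))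
    k = length v ∸ length u
    t = replicate k 0 ++ c ∷ []
    mt = mul-snoc-snoc u 1 (replicate k 0) c
    w = proj₁ mt
    ew : mulRaw m t ≈ w ++ (1 * c) ∷ []
    ew = proj₁ (proj₂ mt)
    length-w : length w ≡ length v
    length-w = trans (proj₂ (proj₂ mt))
      (trans (cong (length u +_) (length-replicate k)) (m+[n∸m]≡n (≤-pred (≤-trans u<f (≤-reflexive ∥f∥)))))
    f₁ = addRaw (norm p f) (neg (mulRaw m t))
    length-v : length v ≡ length (neg w)
    length-v = sym (trans (length-map (suc q *_) w) length-w)
    leading-cancels : (c + suc q * (1 * c)) % p ≡ 0
    leading-cancels = trans (cong (λ z → (c + suc q * z) % p) (*-identityˡ c))
        (trans (cong (_% p) (*-comm p c)) (m*n%n≡0 c p))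
    f₁≈ : f₁ ≈ addRaw v (neg w)
    f₁≈ = add-cong (≡→≈ ef) (scale-cong {suc q} {suc q} refl ew)
        ∙ ≡→≈ (cong (addRaw (v ++ c ∷ [])) (map-++ (suc q *_) w ((1 * c) ∷ [])))
        ∙ ≡→≈ (add-snoc-snoc v (neg w) c (suc q * (1 * c)) length-v)
            ∙ snoc0-≈ (addRaw v (neg w)) _ leading-cancels
    f₁<f : ∥ f₁ ∥ < ∥ f ∥
    f₁<f = subst (∥ f₁ ∥ <_) (sym ∥f∥) (s≤s (≤-trans (≤-reflexive (∥∥-cong f₁≈))
      (≤-trans (∥∥≤len (addRaw v (neg w)))
          (≤-reflexive (trans (length-add-longerʳ v (neg w) (≤-reflexive length-v)) (sym length-v))))))
    f≈ : f ≈ addRaw f₁ (mulRaw m t)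
    f≈ = ≈-sym (≡→≈ (add-assoc (norm p f) (neg (mulRaw m t)) (mulRaw m t))
        ∙ add-cong (norm≈ f) (IsZero-neg-add (mulRaw m t)) ∙ ≡→≈ (add-identityʳ f))

  divide-fuel : ∀ n u f → ∥ f ∥ ≤ n → DivisionBy u f
  divide-fuel n u f f≤n with ∥ f ∥ ≤? length u
  ... | yes small = [] , f , ≈-sym (add-IsZeroˡ (IsZero-mul[] (u ++ 1 ∷ []))) , small
  divide-fuel zero u f f≤n | no big = ⊥-elim (big (≤-trans f≤n z≤n))
  divide-fuel (suc n) u f f≤n | no big with reduce-leading u f (≰⇒> big)
  ... | t , f₁ , f≈ , f₁<f with divide-fuel n u f₁ (≤-pred (≤-trans f₁<f f≤n))
  ... | Q , R , f₁≈ , R≤u = addRaw Q t , R ,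
    f≈ ∙ add-cong f₁≈ (≈-refl {mulRaw m t}) ∙ ≡→≈ (add-swapʳ (mulRaw m Q) R (mulRaw m t))
        ∙ add-cong (≈-sym (mul-distribʳ m Q t)) (≈-refl {R}) ,
    R≤u
    where m = u ++ 1 ∷ []

  divide-monic : ∀ u f → DivisionBy u f
  divide-monic u f = divide-fuel ∥ f ∥ u f ≤-refl

  ∥∥-canonical-snoc : ∀ u a → Canonical p (u ++ a ∷ []) → ∥ u ++ a ∷ [] ∥ ≡ suc (length u)
  ∥∥-canonical-snoc u a e = trans (cong length e) (trans (length-++ u) (+-comm (length u) 1))

  canonical-snoc-≉0 : ∀ u a → Canonical p (u ++ a ∷ []) → ¬ IsZero (u ++ a ∷ [])
  canonical-snoc-≉0 u a e z = 0≢1+n (trans (sym (IsZero⇒∥∥≡0 z)) (∥∥-canonical-snoc u a e))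

  ∣ₚ⇒∥∥≤ : ∀ a b → ¬ IsZero b → a ∣ₚ b → ∥ a ∥ ≤ ∥ b ∥
  ∣ₚ⇒∥∥≤ a b nb (h , e) with IsZero? a | IsZero? h
  ... | yes za | _ = ⊥-elim (nb (≈-sym e ∙ IsZero-mulˡ a h za))
  ... | no _ | yes zh = ⊥-elim (nb (≈-sym e ∙ IsZero-mulʳ a h zh))
  ... | no na | no nh = ≤-pred (≤-trans
      (≤-trans (≤-reflexive (+-comm 1 ∥ a ∥)) (+-monoʳ-≤ ∥ a ∥ (∥∥-pos h nh)))
      (≤-reflexive (trans (sym (∥∥-mul a h na nh)) (cong suc (∥∥-cong e)))))

  remainder-≈ : ∀ {f g R} → f ≈ addRaw g R → R ≈ addRaw f (neg g)
  remainder-≈ {f} {g} {R} e =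
    ≈-sym (add-cong e (≈-refl {neg g}) ∙ ≡→≈ (add-swapʳ g R (neg g)) ∙ add-IsZeroˡ (IsZero-add-neg g))

  ∣ₚ-sub : ∀ {d f g} → d ∣ₚ f → d ∣ₚ g → d ∣ₚ addRaw f (neg g)
  ∣ₚ-sub {d} d∣f d∣g = ∣ₚ-add {d} d∣f (∣ₚ-scale {d} (suc q) d∣g)

  ∣ₚ-remainder : ∀ {d f g h R} b → f ≈ addRaw (mulRaw g h) R →
                 d ∣ₚ mulRaw f b → d ∣ₚ mulRaw g b → d ∣ₚ mulRaw R b
  ∣ₚ-remainder {d} {f} {g} {h} {R} b e d∣fb d∣gb =
    ∣ₚ-respʳ {d} Rb≈ (∣ₚ-sub {d} d∣fb (∣ₚ-respʳ {d} gbh≈ghb (∣ₚ-mulʳ {d} h d∣gb)))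
    where
    gbh≈ghb : mulRaw (mulRaw g b) h ≈ mulRaw (mulRaw g h) b
    gbh≈ghb = mul-assoc g b h ∙ mul-cong {g} ≈-refl (mul-comm b h) ∙ ≈-sym (mul-assoc g h b)
    Rb≈ : addRaw (mulRaw f b) (neg (mulRaw (mulRaw g h) b)) ≈ mulRaw R b
    Rb≈ = ≈-sym (mul-cong (remainder-≈ e) (≈-refl {b}) ∙ mul-distribˡ f (neg (mulRaw g h)) b
                 ∙ add-cong {mulRaw f b} ≈-refl (mul-scaleˡ (suc q) (mulRaw g h) b))

  monic-∣ₚ? : ∀ u f → Canonical p (u ++ 1 ∷ []) → Dec ((u ++ 1 ∷ []) ∣ₚ f)
  monic-∣ₚ? u f cm with divide-monic u f
  ... | Q , R , e , R≤u with IsZero? R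
  ... | yes zR = yes (Q , ≈-sym (e ∙ add-IsZeroʳ {mulRaw (u ++ 1 ∷ []) Q} zR))
  ... | no nR = no λ m∣f → <⇒≱ (s≤s R≤u)
      (subst (_≤ ∥ R ∥) (∥∥-canonical-snoc u 1 cm) (∣ₚ⇒∥∥≤ m R nR (m∣R m∣f)))
    where
    m = u ++ 1 ∷ []
    m∣R : m ∣ₚ f → m ∣ₚ R
    m∣R m∣f = ∣ₚ-respʳ {m} (≈-sym (remainder-≈ e)) (∣ₚ-sub {m} m∣f (∣ₚ-mul m Q))

  unit-constant : ∀ a → ∥ a ∥ ≡ 1 → Σ ℕ λ c → (a ≈ c ∷ []) × c % p ≢ 0
  unit-constant a e with IsZero? a
  ... | yes z = ⊥-elim (0≢1+n (trans (sym (IsZero⇒∥∥≡0 z)) e))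
  ... | no na with norm-snoc-view a na
  ... | u , c , ea , nc = c , mk
      (trans (sym (norm-idem a)) (cong (norm p)
      (trans ea (cong (_++ c ∷ []) (len0 u
      (suc-injective (trans (sym (trans (length-++ u) (+-comm (length u) 1)))
      (trans (cong length (sym ea)) e)))))))) , nc
    where
    len0 : ∀ (l : List ℕ) → length l ≡ 0 → l ≡ []
    len0 [] _ = refl

  mul-constants : ∀ d c → mulRaw (d ∷ []) (c ∷ []) ≈ (d * c) ∷ []
  mul-constants d c = ≡→≈ (cong (_∷ []) (+-identityʳ (d * c)))

  unit-inverse : ∀ a → ∥ a ∥ ≡ 1 → Σ ℕ λ d → mulRaw (d ∷ []) a ≈ 1 ∷ []
  unit-inverse a e with unit-constant a e
  ... | c , ea , nc with %-inverse c nc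
  ... | d , ed = d , mul-cong {d ∷ []} ≈-refl ea ∙ mul-constants d c ∙ ≈-∷ {d * c} {1} ed ≈-refl

  ∥constant∥ : ∀ c → c % p ≢ 0 → ∥ c ∷ [] ∥ ≡ 1
  ∥constant∥ c nc with consT-view (c % p) []
  ... | inj₁ e = cong length e
  ... | inj₂ (e , _) = ⊥-elim (nc e)

  scale≈mul-constant : ∀ c f → scale c f ≈ mulRaw (c ∷ []) f
  scale≈mul-constant c f = ≈-sym (add-[0] (scale c f))

  ∣ₚ-scale⁻¹ : ∀ {a b} c → c % p ≢ 0 → a ∣ₚ scale c b → a ∣ₚ b
  ∣ₚ-scale⁻¹ {a} {b} c nc d with %-inverse c nc
  ... | e , ee = ∣ₚ-respʳ {a} (≡→≈ (scale-scale e c b) ∙ scale-cong {e * c} {1} ee ≈-refl ∙ ≡→≈ (scale-one b))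
      (∣ₚ-scale {a} e d)

  monic-associate : ∀ s → ¬ IsZero s → Σ ℕ λ d → Σ (List ℕ) λ u → d % p ≢ 0 × norm p (scale d s) ≡ u ++ 1 ∷ []
  monic-associate s ns with norm-snoc-view s ns
  ... | v , c , es , nc with %-inverse c nc
  ... | d , ed = d , map (red p) (scale d v) , dnz ,
      trans (un (scale-cong {d} {d} {s} {norm p s} refl (≈-sym (norm≈ s))))
      (trans (cong (λ z → norm p (scale d z)) es)
      (trans (cong (norm p) (map-++ (d *_) v (c ∷ [])))
      (trans (norm-snoc (scale d v) (d * c) (λ z → 0≢1+n (trans (sym z) ed)))
      (cong (λ z → map (red p) (scale d v) ++ z ∷ []) ed))))
    where
    dnz : d % p ≢ 0
    dnz z = 0≢1+n (trans (sym (trans (%-distribˡ-* d c p) (cong (λ x → (x * (c % p)) % p) z))) ed)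

  ∥∥-scale : ∀ c s → c % p ≢ 0 → ∥ scale c s ∥ ≡ ∥ s ∥
  ∥∥-scale c s nc with IsZero? s
  ... | yes z = trans (IsZero⇒∥∥≡0 (scale-cong {c} {c} refl z)) (sym (IsZero⇒∥∥≡0 z))
  ... | no ns = suc-injective (trans (cong suc (∥∥-cong (scale≈mul-constant c s ∙ mul-comm (c ∷ []) s)))
      (trans (∥∥-mul s (c ∷ []) ns nZc) (trans (cong (∥ s ∥ +_) (∥constant∥ c nc)) (+-comm ∥ s ∥ 1))))
    where
    nZc : ¬ IsZero (c ∷ [])
    nZc z = 0≢1+n (trans (sym (IsZero⇒∥∥≡0 z)) (∥constant∥ c nc))

  IsIrreducible : List ℕ → Set
  IsIrreducible r = 2 ≤ ∥ r ∥ × (∀ a b → mulRaw a b ≈ r → ∥ a ∥ ≡ 1 ⊎ ∥ b ∥ ≡ 1)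

  module Euclid (ur : List ℕ) (cr : Canonical p (ur ++ 1 ∷ [])) (irr : IsIrreducible (ur ++ 1 ∷ [])) where
    r = ur ++ 1 ∷ []

    nZr : ¬ IsZero r
    nZr = canonical-snoc-≉0 ur 1 cr

    -- Descent on the size of s: divide r by the monic associate of s; a zero remainder would
    -- split r, so the remainder t is a smaller nonzero polynomial with r ∣ t·b.
    euclid-remainder : ∀ n s b → ∥ s ∥ ≤ n → ¬ IsZero s → ∥ s ∥ < ∥ r ∥ → r ∣ₚ mulRaw s b → r ∣ₚ b
    euclid-remainder n s b s≤n ns s<r r∣sb with ∥ s ∥ in ∥s∥
    ... | zero = ⊥-elim (ns (∥∥≡0⇒IsZero s ∥s∥))
    ... | suc zero with unit-inverse s ∥s∥
    ...   | c , ec = ∣ₚ-respʳ {r} (≈-sym (mul-assoc (c ∷ []) s b) ∙ mul-cong ec (≈-refl {b})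
        ∙ mul-identityˡ b) (∣ₚ-mulˡ {r} (c ∷ []) r∣sb)
    euclid-remainder zero s b s≤n ns s<r r∣sb | suc (suc k) = ⊥-elim (n≮0 s≤n)
    euclid-remainder (suc n) s b s≤n ns s<r r∣sb | suc (suc k) with monic-associate s ns
    ... | c , u' , nc , em with divide-monic u' r
    ... | Q , t , et , t≤u' = r∣b
      where
      m = u' ++ 1 ∷ []
      m≈cs : m ≈ scale c s
      m≈cs = mk (trans (cong (norm p) (sym em)) (norm-idem (scale c s)))
      ∥m∥ : ∥ m ∥ ≡ suc (suc k)
      ∥m∥ = trans (∥∥-cong m≈cs) (trans (∥∥-scale c s nc) ∥s∥)
      u'<s : length u' < suc (suc k)
      u'<s = subst (length u' <_) ∥m∥
          (≤-reflexive (sym (∥∥-canonical-snoc u' 1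
          (trans (cong (norm p) (sym em)) (trans (norm-idem (scale c s)) em)))))
      r∣mb : r ∣ₚ mulRaw m b
      r∣mb = ∣ₚ-respʳ {r} (≈-sym (mul-cong m≈cs (≈-refl {b}) ∙ mul-scaleˡ c s b)) (∣ₚ-scale {r} c r∣sb)
      r-splits : IsZero t → ⊥
      r-splits zt with proj₂ irr m Q (≈-sym (et ∙ add-IsZeroʳ {mulRaw m Q} zt))
      ... | inj₁ ∥m∥≡1 = 0≢1+n (sym (suc-injective (trans (sym ∥m∥) ∥m∥≡1)))
      ... | inj₂ ∥Q∥≡1 = <⇒≱ s<r (≤-reflexive
          (suc-injective (trans (cong suc (∥∥-cong (et ∙ add-IsZeroʳ {mulRaw m Q} zt)))
                                  (trans (∥∥-mul m Q m≉0 Q≉0) (trans (cong₂ _+_ ∥m∥ ∥Q∥≡1)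
                                      (+-comm (suc (suc k)) 1))))))
        where
        m≉0 : ¬ IsZero m
        m≉0 z = 0≢1+n (trans (sym (IsZero⇒∥∥≡0 z)) ∥m∥)
        Q≉0 : ¬ IsZero Q
        Q≉0 z = 0≢1+n (trans (sym (IsZero⇒∥∥≡0 z)) ∥Q∥≡1)
      r∣b : r ∣ₚ b
      r∣b with IsZero? t
      ... | yes zt = ⊥-elim (r-splits zt)
      ... | no nt = euclid-remainder n t b (≤-pred (≤-trans (s≤s t≤u') (≤-trans u'<s s≤n))) nt
                      (≤-trans (s≤s t≤u') (≤-trans u'<s (≤-trans (n≤1+n _) s<r)))
                      (∣ₚ-remainder {r} {r} {m} {Q} {t} b et (∣ₚ-mul r b) r∣mb)

    euclid : ∀ a b → r ∣ₚ mulRaw a b → r ∣ₚ a ⊎ r ∣ₚ b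
    euclid a b r∣ab with monic-∣ₚ? ur a cr
    ... | yes r∣a = inj₁ r∣a
    ... | no r∤a with divide-monic ur a
    ... | Q , s , es , s≤ur with IsZero? s
    ...   | yes zs = ⊥-elim (r∤a (Q , ≈-sym (es ∙ add-IsZeroʳ {mulRaw r Q} zs)))
    ...   | no ns = inj₂ (euclid-remainder ∥ s ∥ s b ≤-refl ns s<r
        (∣ₚ-remainder {r} {a} {r} {Q} {s} b es r∣ab (∣ₚ-mul r b)))
      where
      s<r : ∥ s ∥ < ∥ r ∥
      s<r = ≤-trans (s≤s s≤ur) (≤-reflexive (sym (∥∥-canonical-snoc ur 1 cr)))

    coprime-cancel : ∀ d X → ¬ r ∣ₚ d → d ∣ₚ mulRaw r X → d ∣ₚ X
    coprime-cancel d X r∤d (h , e) with euclid d h (∣ₚ-respʳ {r} (≈-sym e) (∣ₚ-mul r X))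
    ... | inj₁ r∣d = ⊥-elim (r∤d r∣d)
    ... | inj₂ (h' , e') = h' , mul-cancelˡ r (mulRaw d h') X nZr
      (≈-sym (mul-assoc r d h') ∙ mul-cong {mulRaw r d} (mul-comm r d) (≈-refl {h'}) ∙ mul-assoc d r h'
          ∙ mul-cong {d} ≈-refl e' ∙ e)

  -- Reciprocals

  data SameCoeffs : List ℕ → List ℕ → Set where
    same[] : SameCoeffs [] []
    same∷ : ∀ {a b x y} → a % p ≡ b % p → SameCoeffs x y → SameCoeffs (a ∷ x) (b ∷ y)

  SameCoeffs⇒≈ : ∀ {x y} → SameCoeffs x y → x ≈ y
  SameCoeffs⇒≈ same[] = ≈-refl
  SameCoeffs⇒≈ (same∷ e xy) = ≈-∷ e (SameCoeffs⇒≈ xy)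

  ≈∧length⇒SameCoeffs : ∀ x y → x ≈ y → length x ≡ length y → SameCoeffs x y
  ≈∧length⇒SameCoeffs [] [] e l = same[]
  ≈∧length⇒SameCoeffs (a ∷ x) (b ∷ y) e l =
      same∷ (proj₁ (≈-∷⁻¹ e)) (≈∧length⇒SameCoeffs x y (proj₂ (≈-∷⁻¹ e)) (suc-injective l))

  SameCoeffs-snoc : ∀ {x y a b} → SameCoeffs x y → a % p ≡ b % p → SameCoeffs (x ++ a ∷ []) (y ++ b ∷ [])
  SameCoeffs-snoc same[] e = same∷ e same[]
  SameCoeffs-snoc (same∷ e' xy) e = same∷ e' (SameCoeffs-snoc xy e)

  SameCoeffs-reverse : ∀ {x y} → SameCoeffs x y → SameCoeffs (reverse x) (reverse y)
  SameCoeffs-reverse same[] = same[]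
  SameCoeffs-reverse {a ∷ x} {b ∷ y} (same∷ e xy) rewrite unfold-reverse a x | unfold-reverse b y =
      SameCoeffs-snoc (SameCoeffs-reverse xy) e

  reverse-cong : ∀ {x y} → x ≈ y → length x ≡ length y → reverse x ≈ reverse y
  reverse-cong {x} {y} e l = SameCoeffs⇒≈ (SameCoeffs-reverse (≈∧length⇒SameCoeffs x y e l))

  add-replicate0 : ∀ z n → n ≤ length z → addRaw z (replicate n 0) ≡ z
  add-replicate0 z zero le = add-identityʳ z
  add-replicate0 (a ∷ z) (suc n) (s≤s le) = cong₂ _∷_ (+-identityʳ a) (add-replicate0 z n le)

  reverse-add : ∀ x y → length x ≤ length y
      → reverse (addRaw x y) ≡ addRaw (reverse y) (replicate (length y ∸ length x) 0 ++ reverse x)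
  reverse-add [] y le = sym (trans (cong (addRaw (reverse y)) (++-identityʳ (replicate (length y) 0)))
      (add-replicate0 (reverse y) (length y) (≤-reflexive (sym (length-reverse y)))))
  reverse-add (a ∷ x) (b ∷ y) (s≤s le) = begin
      reverse ((a + b) ∷ addRaw x y) ≡⟨ unfold-reverse (a + b) (addRaw x y) ⟩
      reverse (addRaw x y) ++ (a + b) ∷ [] ≡⟨ cong (_++ (a + b) ∷ []) (reverse-add x y le) ⟩
      addRaw (reverse y) (rep ++ reverse x) ++ (a + b) ∷ [] ≡⟨ cong
          (λ z → addRaw (reverse y) (rep ++ reverse x) ++ z ∷ []) (+-comm a b) ⟩
      addRaw (reverse y) (rep ++ reverse x) ++ (b + a) ∷ [] ≡⟨ sym
          (add-snoc-snoc (reverse y) (rep ++ reverse x) b a ll) ⟩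
      addRaw (reverse y ++ b ∷ []) ((rep ++ reverse x) ++ a ∷ []) ≡⟨ cong₂ addRaw (sym (unfold-reverse b y))
          (trans (++-assoc rep (reverse x) (a ∷ [])) (cong (rep ++_) (sym (unfold-reverse a x)))) ⟩
      addRaw (reverse (b ∷ y)) (rep ++ reverse (a ∷ x)) ∎
    where
    open ≡-Reasoning
    rep = replicate (length y ∸ length x) 0
    ll : length (reverse y) ≡ length (rep ++ reverse x)
    ll = trans (length-reverse y) (sym
        (trans (length-++ rep) (trans (cong₂ _+_ (length-replicate (length y ∸ length x))
        (length-reverse x)) (m∸n+n≡m le))))

  mul-snocˡ : ∀ u a v → mulRaw (u ++ a ∷ []) v ≈ addRaw (mulRaw u v) (replicate (length u) 0 ++ scale a v)
  mul-snocˡ [] a v = add-[0] (scale a v)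
  mul-snocˡ (b ∷ u) a v = add-cong {scale b v} ≈-refl (≈-∷ {0} {0} refl (mul-snocˡ u a v))
      ∙ ≡→≈ (sym (add-assoc (scale b v) (0 ∷ mulRaw u v) (0 ∷ (replicate (length u) 0 ++ scale a v))))

  length-add-longerˡ : ∀ y z → length z ≤ length y → length (addRaw y z) ≡ length y
  length-add-longerˡ y z le = trans (cong length (add-comm y z)) (length-add-longerʳ z y le)

  length-mul : ∀ a f g → g ≢ [] → suc (length (mulRaw (a ∷ f) g)) ≡ suc (length f) + length g
  length-mul a [] [] ne = ⊥-elim (ne refl)
  length-mul a [] (b ∷ g) ne rewrite add-identityʳ (scale a g) =
      cong (λ z → suc (suc z)) (length-map (a *_) g)
  length-mul a (b ∷ f) g ne = cong suc
      (trans (length-add-longerʳ (scale a g) (0 ∷ mulRaw (b ∷ f) g) le) (length-mul b f g ne))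
    where
    le : length (scale a g) ≤ length (0 ∷ mulRaw (b ∷ f) g)
    le = ≤-trans (≤-reflexive (length-map (a *_) g))
        (≤-trans (m≤n+m (length g) (suc (length f))) (≤-reflexive (sym (length-mul b f g ne))))

  reverse-mul : ∀ f g → g ≢ [] → reverse (mulRaw f g) ≈ mulRaw (reverse f) (reverse g)
  reverse-mul [] g ne = ≈-refl
  reverse-mul (a ∷ []) g ne = reverse-cong (add-[0] (scale a g)) (length-add-longerˡ (scale a g) (0 ∷ []) lg)
      ∙ ≡→≈ (sym (reverse-map (a *_) g)) ∙ ≈-sym (add-[0] (scale a (reverse g)))
    where
    lg' : ∀ h → h ≢ [] → 1 ≤ length (scale a h)
    lg' [] n = ⊥-elim (n refl)
    lg' (b ∷ h) n = s≤s z≤n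
    lg : 1 ≤ length (scale a g)
    lg = lg' g ne
  reverse-mul (a ∷ b ∷ f) g ne = ≡→≈ (reverse-add (scale a g) (0 ∷ mulRaw (b ∷ f) g) le) ∙
      add-cong (≡→≈ (unfold-reverse 0 (mulRaw (b ∷ f) g)) ∙ snoc0-≈ (reverse (mulRaw (b ∷ f) g)) 0 refl
          ∙ reverse-mul (b ∷ f) g ne)
               (≡→≈ (cong₂ (λ x y → replicate x 0 ++ y) dl (sym (reverse-map (a *_) g))))
      ∙ ≈-sym (≡→≈ (cong (λ z → mulRaw z (reverse g)) (unfold-reverse a (b ∷ f)))
          ∙ mul-snocˡ (reverse (b ∷ f)) a (reverse g)
          ∙ ≡→≈ (cong (λ x → addRaw (mulRaw (reverse (b ∷ f)) (reverse g))
          (replicate x 0 ++ scale a (reverse g))) (length-reverse (b ∷ f))))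
    where
    le : length (scale a g) ≤ length (0 ∷ mulRaw (b ∷ f) g)
    le = ≤-trans (≤-reflexive (length-map (a *_) g))
        (≤-trans (m≤n+m (length g) (suc (length f))) (≤-reflexive (sym (length-mul b f g ne))))
    dl : length (0 ∷ mulRaw (b ∷ f) g) ∸ length (scale a g) ≡ length (b ∷ f)
    dl = trans (cong₂ _∸_ (length-mul b f g ne) (length-map (a *_) g)) (m+n∸n≡m (suc (length f)) (length g))

  canonical-∷-≉0 : ∀ {a f} → Canonical p (a ∷ f) → ¬ IsZero (a ∷ f)
  canonical-∷-≉0 {a} {f} c (mk z) = helper (trans (sym c) z)
    where
    helper : a ∷ f ≡ [] → ⊥
    helper ()

  ∥∥-canonical : ∀ {f} → Canonical p f → ∥ f ∥ ≡ length f
  ∥∥-canonical c = cong length c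

  recip-mul : ∀ f g → Canonical p f → Canonical p g
      → recip p (norm p (mulRaw f g)) ≡ norm p (mulRaw (recip p f) (recip p g))
  recip-mul [] g cf cg = refl
  recip-mul (a ∷ f) [] cf cg = trans (cong (recip p) (un (IsZero-mul[] (a ∷ f))))
      (sym (un (IsZero-mul[] (recip p (a ∷ f)))))
  recip-mul (a ∷ f) (b ∷ g) cf cg =
      un (reverse-cong (norm≈ X) lens ∙ reverse-mul (a ∷ f) (b ∷ g) (λ ())
      ∙ mul-cong (≈-sym (norm≈ (reverse (a ∷ f)))) (≈-sym (norm≈ (reverse (b ∷ g)))))
    where
    X = mulRaw (a ∷ f) (b ∷ g)
    lens : length (norm p X) ≡ length X
    lens = suc-injective (trans (∥∥-mul (a ∷ f) (b ∷ g) (canonical-∷-≉0 cf) (canonical-∷-≉0 cg))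
        (trans (cong₂ _+_ (∥∥-canonical cf) (∥∥-canonical cg)) (sym (length-mul a f (b ∷ g) (λ ())))))

  ∥reverse∥ : ∀ c f → c % p ≢ 0 → ∥ reverse (c ∷ f) ∥ ≡ length (c ∷ f)
  ∥reverse∥ c f nc = trans (cong (λ z → length (norm p z)) (unfold-reverse c f))
      (trans (cong length (norm-snoc (reverse f) c nc))
      (trans (length-++ (map (red p) (reverse f)))
      (trans (cong (_+ 1) (trans (length-map (red p) (reverse f)) (length-reverse f)))
      (+-comm (length f) 1))))

  recip-involutive : ∀ c f → Canonical p (c ∷ f) → c % p ≢ 0 → recip p (recip p (c ∷ f)) ≡ c ∷ f
  recip-involutive c f cf nc = trans
      (un (reverse-cong (norm≈ (reverse (c ∷ f))) (trans (∥reverse∥ c f nc) (sym (length-reverse (c ∷ f))))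
      ∙ ≡→≈ (reverse-involutive (c ∷ f)))) cf

  ∥recip∥≤length : ∀ f → ∥ recip p f ∥ ≤ length f
  ∥recip∥≤length f = ≤-trans (≤-reflexive (cong length (norm-idem (reverse f))))
      (≤-trans (length-norm (reverse f)) (≤-reflexive (length-reverse f)))

  selfRecip-head≢0 : ∀ c f → Canonical p (c ∷ f) → recip p (c ∷ f) ≡ c ∷ f → c % p ≢ 0
  selfRecip-head≢0 c f cf sr z = <-irrefl refl (≤-trans (≤-reflexive (sym h1)) h2)
    where
    h1 : length (recip p (c ∷ f)) ≡ suc (length f)
    h1 = cong length sr
    h2 : length (recip p (c ∷ f)) ≤ length f
    h2 = ≤-trans (≤-reflexive (cong length
        (trans (cong (norm p) (unfold-reverse c f)) (un (snoc0-≈ (reverse f) c z)))))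
        (≤-trans (length-norm (reverse f)) (≤-reflexive (length-reverse f)))

  Divides⇒∣ₚ : ∀ {g f} → Divides p g f → Canonical p f → g ∣ₚ f
  Divides⇒∣ₚ {g} {f} (h , ch , e) cf = h , mk (trans e (sym cf))

  ∣ₚ⇒Divides : ∀ {g f} → g ∣ₚ f → Canonical p f → Divides p g f
  ∣ₚ⇒Divides {g} {f} (h , e) cf = norm p h , norm-idem h , trans (sym (un (mul-normʳ g h))) (trans (un e) cf)

  Irreducible⇒IsIrreducible : ∀ {r} → Irreducible p r → IsIrreducible r
  Irreducible⇒IsIrreducible {r} (cr , len , fac) = ≤-trans len (≤-reflexive (sym (∥∥-canonical cr))) ,
      λ a b e → fac (norm p a) (norm p b) (norm-idem a) (norm-idem b)
      (trans (un (≈-sym (mul-normˡ a (norm p b)) ∙ ≈-sym (mul-normʳ a b))) (trans (un e) cr))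

  last-snoc : ∀ (u : List ℕ) a → last (u ++ a ∷ []) ≡ just a
  last-snoc [] a = refl
  last-snoc (x ∷ []) a = refl
  last-snoc (x ∷ y ∷ u) a = last-snoc (y ∷ u) a

  MonicForm : List ℕ → Set
  MonicForm f = Σ (List ℕ) λ u → f ≡ u ++ 1 ∷ []

  Monic⇒MonicForm : ∀ {f} → Monic f → MonicForm f
  Monic⇒MonicForm {f} m with initLast f
  ... | [] = ⊥-elim (helper m)
    where
    helper : last {A = ℕ} [] ≡ just 1 → ⊥
    helper ()
  ... | u ∷ʳ′ a = u , cong (λ z → u ++ z ∷ []) (just-inj (trans (sym (last-snoc u a)) m))
    where
    just-inj : ∀ {x y : ℕ} → just x ≡ just y → x ≡ y
    just-inj refl = refl

  MonicForm⇒Monic : ∀ {f} → MonicForm f → Monic f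
  MonicForm⇒Monic (u , refl) = last-snoc u 1

  canonical-last-reduced : ∀ v b → Canonical p (v ++ b ∷ []) → b % p ≡ b
  canonical-last-reduced v b c with b % p ≟ 0
  ... | yes z = ⊥-elim (canonical⇒last≢0 v b c z)
  ... | no nz = proj₂ (∷ʳ-injective (map (red p) v) v (trans (sym (norm-snoc v b nz)) c))

  MonicForm-mul : ∀ f g → Canonical p f → Canonical p g → MonicForm f → MonicForm g
      → MonicForm (norm p (mulRaw f g))
  MonicForm-mul f g cf cg (u , refl) (v , refl) with leading-mul (u ++ 1 ∷ []) (v ++ 1 ∷ []) u 1 v 1
      cf cg (λ ()) (λ ())
  ... | w , e , _ = w , e

  MonicForm-cofactor : ∀ f g → Canonical p f → Canonical p g → ¬ IsZero g → MonicForm f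
      → MonicForm (norm p (mulRaw f g)) → MonicForm g
  MonicForm-cofactor f g cf cg g≉0 (u , refl) (v , ev) with canonical-snoc-view g cg
      (λ e → g≉0 (mk (trans cg e)))
  ... | w , b , refl , nb with leading-mul (u ++ 1 ∷ []) (w ++ b ∷ []) u 1 w b cf cg (λ ()) nb
  ... | w' , e' , _ = w , cong (λ z → w ++ z ∷ [])
      (trans (sym (canonical-last-reduced w b cg))
      (trans (cong (_% p) (sym (+-identityʳ b))) (proj₂ (∷ʳ-injective w' v (trans (sym e') ev)))))

  pow-canonical : ∀ f k → Canonical p (pow p f k)
  pow-canonical f zero = refl
  pow-canonical f (suc k) = norm-idem (mulRaw f (pow p f k))

  pow-suc : ∀ f k → pow p f (suc k) ≈ mulRaw f (pow p f k)
  pow-suc f k = norm≈ (mulRaw f (pow p f k))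

  pow-+ : ∀ f a b → pow p f (a + b) ≈ mulRaw (pow p f a) (pow p f b)
  pow-+ f zero b = ≈-sym (mul-identityˡ (pow p f b)) ∙ ≈-refl
  pow-+ f (suc a) b = pow-suc f (a + b) ∙ mul-cong {f} ≈-refl (pow-+ f a b)
      ∙ ≈-sym (mul-assoc f (pow p f a) (pow p f b)) ∙ mul-cong (≈-sym (pow-suc f a)) (≈-refl {pow p f b})

  pow-MonicForm : ∀ f k → Canonical p f → MonicForm f → MonicForm (pow p f k)
  pow-MonicForm f zero cf mf = [] , refl
  pow-MonicForm f (suc k) cf mf =
      MonicForm-mul f (pow p f k) cf (pow-canonical f k) mf (pow-MonicForm f k cf mf)

  length-pow : ∀ u k → Canonical p (u ++ 1 ∷ []) → length (pow p (u ++ 1 ∷ []) k) ≡ suc (k * length u)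
  length-pow u zero c = refl
  length-pow u (suc k) c = suc-injective
      (trans (∥∥-mul (u ++ 1 ∷ []) (pow p (u ++ 1 ∷ []) k) (canonical-snoc-≉0 u 1 c) npk)
      (trans (cong₂ _+_ (∥∥-canonical-snoc u 1 c)
      (trans (∥∥-canonical (pow-canonical (u ++ 1 ∷ []) k)) (length-pow u k c)))
      (cong suc (+-suc (length u) (k * length u)))))
    where
    npk : ¬ IsZero (pow p (u ++ 1 ∷ []) k)
    npk z = 0≢1+n (trans (sym (trans (sym (∥∥-canonical (pow-canonical (u ++ 1 ∷ []) k))) (IsZero⇒∥∥≡0 z)))
        (length-pow u k c))

  pow-selfRecip : ∀ f k → Canonical p f → recip p f ≡ f → recip p (pow p f k) ≡ pow p f k
  pow-selfRecip f zero cf sf = refl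
  pow-selfRecip f (suc k) cf sf =
      trans (recip-mul f (pow p f k) cf (pow-canonical f k))
      (cong₂ (λ x y → norm p (mulRaw x y)) sf (pow-selfRecip f k cf sf))

  recip-canonical : ∀ f → Canonical p (recip p f)
  recip-canonical f = norm-idem (reverse f)

  canonical-≈⇒≡ : ∀ {f g} → Canonical p f → Canonical p g → f ≈ g → f ≡ g
  canonical-≈⇒≡ cf cg (mk e) = trans (sym cf) (trans e cg)

  CanonicalSR : List ℕ → Set
  CanonicalSR d = Canonical p d × ¬ IsZero d × recip p d ≡ d

  -- Counting self-reciprocal polynomials

  canonical-∷⁻¹ : ∀ a f → Canonical p (a ∷ f) → a % p ≡ a × Canonical p f
  canonical-∷⁻¹ a f c with consT-view (a % p) (norm p f)
  ... | inj₁ e = ∷-injective (trans (sym e) c)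
  ... | inj₂ (e1 , e2) = ⊥-elim (helper (trans (sym (trans (cong₂ consT e1 e2) refl)) c))
    where
    helper : [] ≡ a ∷ f → ⊥
    helper ()

  Reduced : List ℕ → Set
  Reduced xs = map (red p) xs ≡ xs

  canonical⇒Reduced : ∀ f → Canonical p f → Reduced f
  canonical⇒Reduced [] c = refl
  canonical⇒Reduced (a ∷ f) c = cong₂ _∷_ (proj₁ (canonical-∷⁻¹ a f c))
      (canonical⇒Reduced f (proj₂ (canonical-∷⁻¹ a f c)))

  Reduced-reverse : ∀ xs → Reduced xs → Reduced (reverse xs)
  Reduced-reverse xs r = trans (reverse-map (red p) xs) (cong reverse r)

  strip-++ : ∀ xs zs → strip zs ≢ [] → strip (xs ++ zs) ≡ xs ++ strip zs
  strip-++ [] zs ne = refl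
  strip-++ (x ∷ xs) zs ne = trans (cong (consT x) (strip-++ xs zs ne)) (consT-ne x (xs ++ strip zs) (ne' xs))
    where
    ne' : ∀ (l : List ℕ) → l ++ strip zs ≢ []
    ne' [] e = ne e
    ne' (y ∷ l) ()

  canonical-++ : ∀ xs ys → Reduced xs → Canonical p ys → ys ≢ [] → Canonical p (xs ++ ys)
  canonical-++ xs ys rx cy ne = trans (cong strip (map-++ (red p) xs ys))
      (trans (cong (λ z → strip (z ++ map (red p) ys)) rx)
      (trans (strip-++ xs (map (red p) ys) (λ e → ne (trans (sym cy) e))) (cong (xs ++_) cy)))

  canonical-++⁻¹ : ∀ xs ys → Canonical p (xs ++ ys) → Canonical p ys
  canonical-++⁻¹ [] ys c = c
  canonical-++⁻¹ (x ∷ xs) ys c = canonical-++⁻¹ xs ys (proj₂ (canonical-∷⁻¹ x (xs ++ ys) c))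

  ++-cancel-same-length : ∀ (xs ys xs' ys' : List ℕ) → length xs ≡ length xs' → xs ++ ys ≡ xs' ++ ys'
      → xs ≡ xs' × ys ≡ ys'
  ++-cancel-same-length [] ys [] ys' l e = refl , e
  ++-cancel-same-length (x ∷ xs) ys (x' ∷ xs') ys' l e with ∷-injective e
  ... | refl , e' = let (a , b) = ++-cancel-same-length xs ys xs' ys' (suc-injective l) e' in cong (x ∷_) a , b

  splitAt-length : ∀ m (g : List ℕ) → m ≤ length g
      → Σ (List ℕ) λ A → Σ (List ℕ) λ h → g ≡ A ++ h × length A ≡ m
  splitAt-length zero g le = [] , g , refl , refl
  splitAt-length (suc m) (x ∷ g) (s≤s le) with splitAt-length m g le
  ... | A , h , e , l = x ∷ A , h , cong (x ∷_) e , cong suc l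

  canonical-IsZero⇒≡[] : ∀ {f} → Canonical p f → IsZero f → f ≡ []
  canonical-IsZero⇒≡[] c (mk z) = trans (sym c) z

  DegreeBelow : ℕ → List ℕ → Set
  DegreeBelow N g = Canonical p g × length g ≤ N

  ConsBelow : ℕ → ℕ → List ℕ → Set
  ConsBelow N k g = Σ ℕ λ a → a < k × Σ (List ℕ) λ f → DegreeBelow N f × g ≡ consT a f

  consT-injectiveˡ : ∀ {a b u v} → consT a u ≡ consT b v → a ≡ b
  consT-injectiveˡ e = proj₁ (consT-injective e)

  HasCard-ConsBelow : ∀ N k → HasCard (DegreeBelow N) (p ^ N) → HasCard (ConsBelow N k) (k * p ^ N)
  HasCard-ConsBelow N zero h = HasCard-∅ (λ { g (a , () , _) })
  HasCard-ConsBelow N (suc k) h = subst (HasCard (ConsBelow N (suc k))) (+-comm (k * p ^ N) (p ^ N))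
    (HasCard-⇔ (HasCard-⊎ (HasCard-ConsBelow N k h)
        (HasCard-image h (consT k) (λ x y _ _ e → proj₂ (consT-injective e))) disj) fwd bwd)
    where
    disj : ∀ g → ConsBelow N k g → (Σ (List ℕ) λ x → DegreeBelow N x × g ≡ consT k x) → ⊥
    disj g (a , lt , f , cf , e) (x , cx , e') = <-irrefl (consT-injectiveˡ (trans (sym e) e')) lt
    fwd : ∀ g → ConsBelow N k g ⊎ (Σ (List ℕ) λ x → DegreeBelow N x × g ≡ consT k x) → ConsBelow N (suc k) g
    fwd g (inj₁ (a , lt , f , cf , e)) = a , ≤-trans lt (n≤1+n k) , f , cf , e
    fwd g (inj₂ (x , cx , e)) = k , ≤-refl , x , cx , e
    bwd : ∀ g → ConsBelow N (suc k) g → ConsBelow N k g ⊎ (Σ (List ℕ) λ x → DegreeBelow N x × g ≡ consT k x)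
    bwd g (a , lt , f , cf , e) with m≤n⇒m<n∨m≡n (≤-pred lt)
    ... | inj₁ lt' = inj₁ (a , lt' , f , cf , e)
    ... | inj₂ refl = inj₂ (f , cf , e)

  HasCard-DegreeBelow : ∀ N → HasCard (DegreeBelow N) (p ^ N)
  HasCard-DegreeBelow zero = HasCard-⇔ (HasCard-≡ []) (λ { g refl → refl , z≤n })
      (λ { [] _ → refl ; (x ∷ g) (_ , ()) })
  HasCard-DegreeBelow (suc N) = HasCard-⇔ (HasCard-ConsBelow N p (HasCard-DegreeBelow N)) fwd bwd
    where
    fwd : ∀ g → ConsBelow N p g → DegreeBelow (suc N) g
    fwd g (a , lt , f , (cf , lf) , refl) = trans (norm-consT a f) (cong₂ consT (m<n⇒m%n≡m lt) cf) ,
        ≤-trans (length-consT a f) (s≤s lf)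
    bwd : ∀ g → DegreeBelow (suc N) g → ConsBelow N p g
    bwd [] _ = 0 , s≤s z≤n , [] , (refl , z≤n) , refl
    bwd (a ∷ f) (cg , s≤s lf) with canonical-∷⁻¹ a f cg
    ... | ea , cf = a , subst (_< p) ea (m%n<n a p) , f , (cf , lf) , sym (ce a f cg)
      where
      ce : ∀ a f → Canonical p (a ∷ f) → consT a f ≡ a ∷ f
      ce zero [] ()
      ce (suc a) [] _ = refl
      ce zero (x ∷ f) _ = refl
      ce (suc a) (x ∷ f) _ = refl

  HasCard-nonzero-DegreeBelow : ∀ N → HasCard (λ g → DegreeBelow N g × ¬ (g ≡ [])) (p ^ N ∸ 1)
  HasCard-nonzero-DegreeBelow N with HasCard-split (HasCard-DegreeBelow N) (λ g → g ≟ₗ [])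
    where
    _≟ₗ_ : (x y : List ℕ) → Dec (x ≡ y)
    _≟ₗ_ = ≡-dec _≟_
  ... | n₁ , n₂ , h1 , h2 , e = subst (HasCard _) (trans (sym (m+n∸m≡n n₁ n₂)) (cong₂ _∸_ e n1≡1)) h2
    where
    n1≡1 : n₁ ≡ 1
    n1≡1 = HasCard-unique h1 (HasCard-⇔ (HasCard-≡ []) (λ { g refl → (refl , z≤n) , refl }) (λ g x → proj₂ x))

  EvenSR : ℕ → List ℕ → Set
  EvenSR N g = CanonicalSR g × 2 ∣ deg g × deg g < N + N

  palindrome : List ℕ → List ℕ
  palindrome [] = []
  palindrome (c ∷ t) = reverse t ++ c ∷ t

  n*2≡n+n : ∀ n → n * 2 ≡ n + n
  n*2≡n+n n = trans (*-comm n 2) (cong (n +_) (+-identityʳ n))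

  n+n-injective : ∀ {n m} → n + n ≡ m + m → n ≡ m
  n+n-injective {n} {m} e = trans (n≡⌊n+n/2⌋ n) (trans (cong ⌊_/2⌋ e) (sym (n≡⌊n+n/2⌋ m)))

  length-palindrome : ∀ c t → length (palindrome (c ∷ t)) ≡ suc (length t + length t)
  length-palindrome c t = trans (length-++ (reverse t))
      (trans (cong (_+ suc (length t)) (length-reverse t)) (+-suc (length t) (length t)))

  canonical-constant : ∀ c → c % p ≡ c → c % p ≢ 0 → Canonical p (c ∷ [])
  canonical-constant c e nz = trans (consT-nz (c % p) nz) (cong (_∷ []) e)
    where
    consT-nz : ∀ x → x ≢ 0 → consT x [] ≡ x ∷ []
    consT-nz zero n = ⊥-elim (n refl)
    consT-nz (suc x) n = refl

  reverse-palindrome : ∀ c t → reverse (palindrome (c ∷ t)) ≡ palindrome (c ∷ t)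
  reverse-palindrome c t = trans (reverse-++ (reverse t) (c ∷ t))
      (trans (cong₂ _++_ (unfold-reverse c t) (reverse-involutive t)) (++-assoc (reverse t) (c ∷ []) t))

  palindrome-injective : ∀ c t c' t' → palindrome (c ∷ t) ≡ palindrome (c' ∷ t') → c ∷ t ≡ c' ∷ t'
  palindrome-injective c t c' t' e =
    proj₂ (++-cancel-same-length (reverse t) (c ∷ t) (reverse t') (c' ∷ t')
        (trans (length-reverse t) (trans |t| (sym (length-reverse t')))) e)
    where
    |t| : length t ≡ length t'
    |t| = n+n-injective (suc-injective
        (trans (sym (length-palindrome c t)) (trans (cong length e) (length-palindrome c' t'))))

  palindrome-EvenSR : ∀ N c t → DegreeBelow N (c ∷ t) → EvenSR N (palindrome (c ∷ t))
  palindrome-EvenSR N c t (ch , |t|<N) =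
    (canonical , nonzero , selfRecip) , divides (length t) (trans deg≡ (sym (n*2≡n+n (length t)))) ,
    subst (_< N + N) (sym deg≡) (+-mono-< |t|<N |t|<N)
    where
    canonical : Canonical p (palindrome (c ∷ t))
    canonical = canonical-++ (reverse t) (c ∷ t)
        (Reduced-reverse t (canonical⇒Reduced t (proj₂ (canonical-∷⁻¹ c t ch)))) ch (λ ())
    nonzero : ¬ IsZero (palindrome (c ∷ t))
    nonzero z = ++-∷-≢[] (reverse t) c t (canonical-IsZero⇒≡[] canonical z)
    selfRecip : recip p (palindrome (c ∷ t)) ≡ palindrome (c ∷ t)
    selfRecip = trans (cong (norm p) (reverse-palindrome c t)) canonical
    deg≡ : deg (palindrome (c ∷ t)) ≡ length t + length t
    deg≡ = cong (_∸ 1) (length-palindrome c t)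

  selfRecip⇒reverse≡ : ∀ c g → Canonical p (c ∷ g) → recip p (c ∷ g) ≡ c ∷ g → reverse (c ∷ g) ≡ c ∷ g
  selfRecip⇒reverse≡ c g cg sr =
      trans (sym (trans (cong (norm p) (unfold-reverse c g)) (trans canonical (sym (unfold-reverse c g))))) sr
    where
    canonical : Canonical p (reverse g ++ c ∷ [])
    canonical = canonical-++ (reverse g) (c ∷ [])
        (Reduced-reverse g (canonical⇒Reduced g (proj₂ (canonical-∷⁻¹ c g cg))))
                  (canonical-constant c (proj₁ (canonical-∷⁻¹ c g cg)) (selfRecip-head≢0 c g cg sr)) (λ ())

  reverse≡⇒palindrome : ∀ m (g : List ℕ) → length g ≡ suc (m + m) → reverse g ≡ g →
    Σ ℕ λ c → Σ (List ℕ) λ t → length t ≡ m × g ≡ palindrome (c ∷ t)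
  reverse≡⇒palindrome m g |g| rev =
      split (splitAt-length m g (≤-trans (m≤m+n m m) (≤-trans (n≤1+n _) (≤-reflexive (sym |g|)))))
    where
    length-suffix : ∀ A h → g ≡ A ++ h → length A ≡ m → length h ≡ suc m
    length-suffix A h e |A| = +-cancelˡ-≡ m _ _
      (trans (sym (trans (length-++ A) (cong (_+ length h) |A|)))
          (trans (cong length (sym e)) (trans |g| (sym (+-suc m m)))))
    split : (Σ (List ℕ) λ A → Σ (List ℕ) λ h → g ≡ A ++ h × length A ≡ m) →
            Σ ℕ λ c → Σ (List ℕ) λ t → length t ≡ m × g ≡ palindrome (c ∷ t)
    split (A , [] , e , |A|) = ⊥-elim (0≢1+n (length-suffix A [] e |A|))
    split (A , c ∷ t , e , |A|) = c , t , |t| , trans e (cong (_++ c ∷ t) (sym reverse-t≡A))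
      where
      |t| : length t ≡ m
      |t| = suc-injective (length-suffix A (c ∷ t) e |A|)
      mirrored : reverse t ++ c ∷ reverse A ≡ A ++ c ∷ t
      mirrored = trans (sym (++-assoc (reverse t) (c ∷ []) (reverse A)))
        (trans (cong (_++ reverse A) (sym (unfold-reverse c t)))
        (trans (sym (reverse-++ A (c ∷ t))) (trans (cong reverse (sym e)) (trans rev e))))
      reverse-t≡A : reverse t ≡ A
      reverse-t≡A = proj₁ (++-cancel-same-length (reverse t) (c ∷ reverse A) A (c ∷ t)
          (trans (length-reverse t) (trans |t| (sym |A|))) mirrored)

  EvenSR⇒palindrome : ∀ N g → EvenSR N g → Σ (List ℕ) λ x → (DegreeBelow N x × ¬ x ≡ []) × g ≡ palindrome x
  EvenSR⇒palindrome N [] ((_ , nz , _) , _) = ⊥-elim (nz ≈-refl)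
  EvenSR⇒palindrome N (c ∷ g) ((cg , _ , sr) , divides m em , deg<) with
    reverse≡⇒palindrome m (c ∷ g) (cong suc (trans em (n*2≡n+n m))) (selfRecip⇒reverse≡ c g cg sr)
  ... | c' , t , |t| , e = c' ∷ t , ((canonical , subst (_≤ N) (cong suc (sym |t|)) m<N) , (λ ())) , e
    where
    canonical : Canonical p (c' ∷ t)
    canonical = canonical-++⁻¹ (reverse t) (c' ∷ t) (subst (Canonical p) e cg)
    m<N : m < N
    m<N = ≰⇒> λ N≤m → <⇒≱ deg< (subst (N + N ≤_) (sym (trans em (n*2≡n+n m))) (+-mono-≤ N≤m N≤m))

  -- Even-degree self-reciprocal polynomials of degree < 2N are the palindromes reverse t ++ c ∷ t
  -- on their nonzero "upper halves" c ∷ t of length ≤ N.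
  HasCard-EvenSR : ∀ N → HasCard (EvenSR N) (p ^ N ∸ 1)
  HasCard-EvenSR N = HasCard-⇔ (HasCard-image (HasCard-nonzero-DegreeBelow N) palindrome injective)
      upper-half→ ←upper-half
    where
    injective : ∀ x y → DegreeBelow N x × ¬ x ≡ [] → DegreeBelow N y × ¬ y ≡ []
        → palindrome x ≡ palindrome y → x ≡ y
    injective [] y (_ , x≢[]) _ _ = ⊥-elim (x≢[] refl)
    injective (c ∷ t) [] _ (_ , y≢[]) _ = ⊥-elim (y≢[] refl)
    injective (c ∷ t) (c' ∷ t') _ _ e = palindrome-injective c t c' t' e
    upper-half→ : ∀ g → (Σ (List ℕ) λ x → (DegreeBelow N x × ¬ x ≡ []) × g ≡ palindrome x) → EvenSR N g
    upper-half→ g ([] , (_ , x≢[]) , _) = ⊥-elim (x≢[] refl)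
    upper-half→ g ((c ∷ t) , (below , _) , refl) = palindrome-EvenSR N c t below
    ←upper-half : ∀ g → EvenSR N g → Σ (List ℕ) λ x → (DegreeBelow N x × ¬ x ≡ []) × g ≡ palindrome x
    ←upper-half = EvenSR⇒palindrome N

  [m+m]+[n+n]≡[m+n]+[m+n] : ∀ m n → (m + m) + (n + n) ≡ (m + n) + (m + n)
  [m+m]+[n+n]≡[m+n]+[m+n] m n = begin
    (m + m) + (n + n) ≡⟨ +-assoc m m (n + n) ⟩
    m + (m + (n + n)) ≡⟨ cong (m +_) (sym (+-assoc m n n)) ⟩
    m + ((m + n) + n) ≡⟨ cong (λ z → m + (z + n)) (+-comm m n) ⟩
    m + ((n + m) + n) ≡⟨ cong (m +_) (+-assoc n m n) ⟩
    m + (n + (m + n)) ≡⟨ sym (+-assoc m n (m + n)) ⟩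
    (m + n) + (m + n) ∎
    where open ≡-Reasoning

  [d+d]+[n∸d+n∸d]≡n+n : ∀ d n → d ≤ n → (d + d) + ((n ∸ d) + (n ∸ d)) ≡ n + n
  [d+d]+[n∸d+n∸d]≡n+n d n d≤n = trans ([m+m]+[n+n]≡[m+n]+[m+n] d (n ∸ d))
      (cong₂ _+_ (m+[n∸m]≡n d≤n) (m+[n∸m]≡n d≤n))

  ≉0⇒≢[] : ∀ {g} → ¬ IsZero g → ¬ g ≡ []
  ≉0⇒≢[] nz refl = nz ≈-refl

  ≢[]⇒≉0 : ∀ {g} → Canonical p g → ¬ g ≡ [] → ¬ IsZero g
  ≢[]⇒≉0 c ne z = ne (canonical-IsZero⇒≡[] c z)

  -- Self-reciprocal divisors of powers

  -- What the counting needs from a monic self-reciprocal r = ur ++ [1] of even degree. It holds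
  -- for irreducible self-reciprocal r, for r = u·g·g*, and for r = (x ± 1)².
  record SRPrime (ur : List ℕ) : Set where
    field
      cr : Canonical p (ur ++ 1 ∷ [])
      sr : recip p (ur ++ 1 ∷ []) ≡ ur ++ 1 ∷ []
      evr : 2 ∣ length ur
      posr : 1 ≤ length ur
      divides-or-cancels : ∀ d → CanonicalSR d → 2 ∣ deg d
          → (ur ++ 1 ∷ []) ∣ₚ d ⊎ (∀ X → d ∣ₚ mulRaw (ur ++ 1 ∷ []) X → d ∣ₚ X)
      unit-or-absorbs : ∀ j e → e ∣ₚ pow p (ur ++ 1 ∷ []) j
          → ∥ e ∥ ≡ 1 ⊎ (∀ g → CanonicalSR g → 2 ∣ deg g → e ∣ₚ g → (ur ++ 1 ∷ []) ∣ₚ g)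

  module PowersOf (ur : List ℕ) (srPrime : SRPrime ur) where
    open SRPrime srPrime
    r = ur ++ 1 ∷ []

    nZr : ¬ IsZero r
    nZr = canonical-snoc-≉0 ur 1 cr

    record Cofactor (d : List ℕ) : Set where
      field
        d' : List ℕ
        cd' : Canonical p d'
        ed : d ≡ norm p (mulRaw r d')
        nd' : ¬ IsZero d'

    cofactor : ∀ d → Canonical p d → ¬ IsZero d → r ∣ₚ d → Cofactor d
    cofactor d cd nd (h , e) = record { d' = norm p h ; cd' = norm-idem h ; ed =
        trans (sym cd) (sym (trans (un (≈-sym (mul-normʳ r h))) (un e))) ; nd' =
        λ z → nd (≈-sym e ∙ mul-normʳ r h ∙ IsZero-mulʳ r (norm p h) z) }

    cofactor-selfRecip : ∀ d → CanonicalSR d → (Qd : Cofactor d) → recip p (Cofactor.d' Qd) ≡ Cofactor.d' Qd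
    cofactor-selfRecip d (cd , nd , sd) Qd =
        canonical-≈⇒≡ (recip-canonical d') cd'
        (mul-cancelˡ r (recip p d') d' nZr
        (mk (trans (sym (trans (recip-mul r d' cr cd') (cong (λ z → norm p (mulRaw z (recip p d'))) sr)))
        (trans (cong (recip p) (sym ed)) (trans sd ed)))))
      where open Cofactor Qd

    length-mul-r : ∀ d' → Canonical p d' → ¬ IsZero d' → length (norm p (mulRaw r d')) ≡ length ur + length d'
    length-mul-r d' cd' nd' = suc-injective
        (trans (∥∥-mul r d' nZr nd') (cong₂ _+_ (∥∥-canonical-snoc ur 1 cr) (∥∥-canonical cd')))

    deg-cofactor : ∀ d → Canonical p d → (Qd : Cofactor d) → deg d ≡ length ur + deg (Cofactor.d' Qd)
    deg-cofactor d cd Qd = trans (cong (λ z → length z ∸ 1) ed)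
        (trans (cong (_∸ 1) (length-mul-r d' cd' nd')) (+-∸-assoc (length ur) (pos1 d' cd' nd')))
      where
      open Cofactor Qd
      pos1 : ∀ x → Canonical p x → ¬ IsZero x → 1 ≤ length x
      pos1 x cx nx = ≤-trans (∥∥-pos x nx) (≤-reflexive (∥∥-canonical cx))

    SRDivisor⇒pow : ∀ k d → CanonicalSR d → MonicForm d → 2 ∣ deg d → d ∣ₚ pow p r k
        → Σ ℕ λ i → i ≤ k × d ≡ pow p r i
    SRDivisor⇒pow zero d (cd , nd , sd) (u , eu) even dv = 0 , z≤n , trans eu (cong (_++ 1 ∷ []) (len0 u lu))
      where
      len0 : ∀ (l : List ℕ) → length l ≡ 0 → l ≡ []
      len0 [] _ = refl
      s1 : ∥ d ∥ ≤ 1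
      s1 = ∣ₚ⇒∥∥≤ d (1 ∷ []) (λ { (mk ()) }) dv
      lu : length u ≡ 0
      lu = suc-injective (≤-antisym (≤-trans
          (≤-reflexive (trans (trans (+-comm 1 (length u)) (sym (length-++ u))) (cong length (sym eu))))
          (≤-trans (≤-reflexive (sym (∥∥-canonical cd))) s1)) (s≤s z≤n))
    SRDivisor⇒pow (suc k) d srd@(cd , nd , sd) md even dv with divides-or-cancels d srd even
    ... | inj₂ h with SRDivisor⇒pow k d srd md even (h (pow p r k) (∣ₚ-respʳ {d} (pow-suc r k) dv))
    ...   | i , le , e = i , ≤-trans le (n≤1+n k) , e
    SRDivisor⇒pow (suc k) d srd@(cd , nd , sd) md even dv | inj₁ rd with cofactor d cd nd rd
    ... | Qd with SRDivisor⇒pow k (Cofactor.d' Qd)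
        (Cofactor.cd' Qd , Cofactor.nd' Qd , cofactor-selfRecip d srd Qd)
        (MonicForm-cofactor r (Cofactor.d' Qd) cr (Cofactor.cd' Qd) (Cofactor.nd' Qd) (ur , refl)
        (subst MonicForm (Cofactor.ed Qd) md)) ev' dv'
      where
      ev' : 2 ∣ deg (Cofactor.d' Qd)
      ev' = ∣m+n∣m⇒∣n (subst (2 ∣_) (deg-cofactor d cd Qd) even) evr
      dv' : Cofactor.d' Qd ∣ₚ pow p r k
      dv' = proj₁ dv , mul-cancelˡ r (mulRaw (Cofactor.d' Qd) (proj₁ dv)) (pow p r k) nZr
          (≈-sym (mul-assoc r (Cofactor.d' Qd) (proj₁ dv))
          ∙ mul-cong (≈-sym (≡→≈ (Cofactor.ed Qd) ∙ norm≈ (mulRaw r (Cofactor.d' Qd)))) (≈-refl {proj₁ dv})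
          ∙ proj₂ dv ∙ pow-suc r k)
    ... | i , le , e = suc i , s≤s le , trans (Cofactor.ed Qd) (cong (λ z → norm p (mulRaw r z)) e)

    Dh : ℕ
    Dh = _∣_.quotient evr
    lur : length ur ≡ Dh + Dh
    lur = trans (_∣_.equality evr) (n*2≡n+n Dh)

    mul-r : List ℕ → List ℕ
    mul-r h = norm p (mulRaw r h)

    deg-mulr : ∀ h → Canonical p h → ¬ IsZero h → deg (mul-r h) ≡ length ur + deg h
    deg-mulr h ch nh = trans (cong (_∸ 1) (length-mul-r h ch nh))
        (+-∸-assoc (length ur) (≤-trans (∥∥-pos h nh) (≤-reflexive (∥∥-canonical ch))))

    HasCard-EvenSR-multiples : ∀ N → Dh ≤ N → HasCard (λ g → EvenSR N g × r ∣ₚ g) (p ^ (N ∸ Dh) ∸ 1)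
    HasCard-EvenSR-multiples N le = HasCard-⇔ (HasCard-image (HasCard-EvenSR (N ∸ Dh)) mul-r inj) fwd bwd
      where
      inj : ∀ x y → EvenSR (N ∸ Dh) x → EvenSR (N ∸ Dh) y → mul-r x ≡ mul-r y → x ≡ y
      inj x y ((cx , _) , _) ((cy , _) , _) e = canonical-≈⇒≡ cx cy (mul-cancelˡ r x y nZr (mk e))
      fwd : ∀ g → (Σ (List ℕ) λ h → EvenSR (N ∸ Dh) h × g ≡ mul-r h) → EvenSR N g × r ∣ₚ g
      fwd g (h , ((ch , nh , sh) , eh , lh) , refl) = ((norm-idem (mulRaw r h) , nzm , srm) , even , lt) ,
          (h , ≈-sym (norm≈ (mulRaw r h)))
        where
        nzm : ¬ IsZero (mul-r h)
        nzm z = mul-≉0 r h nZr nh (≈-sym (norm≈ (mulRaw r h)) ∙ z)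
        srm : recip p (mul-r h) ≡ mul-r h
        srm = trans (recip-mul r h cr ch) (cong₂ (λ x y → norm p (mulRaw x y)) sr sh)
        even : 2 ∣ deg (mul-r h)
        even = subst (2 ∣_) (sym (deg-mulr h ch nh)) (∣m∣n⇒∣m+n evr eh)
        lt : deg (mul-r h) < N + N
        lt = subst (_< N + N) (sym (deg-mulr h ch nh))
            (subst (λ z → length ur + deg h < z) ([d+d]+[n∸d+n∸d]≡n+n Dh N le)
            (subst (λ z → z + deg h < (Dh + Dh) + ((N ∸ Dh) + (N ∸ Dh))) (sym lur) (+-monoʳ-< (Dh + Dh) lh)))
      bwd : ∀ g → EvenSR N g × r ∣ₚ g → Σ (List ℕ) λ h → EvenSR (N ∸ Dh) h × g ≡ mul-r h
      bwd g (((cg , ng , sg) , eg , lg) , dv) = Cofactor.d' Qd ,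
          ((Cofactor.cd' Qd , Cofactor.nd' Qd , cofactor-selfRecip g (cg , ng , sg) Qd) , even ,
          lt) , Cofactor.ed Qd
        where
        Qd = cofactor g cg ng dv
        qd = deg-cofactor g cg Qd
        even : 2 ∣ deg (Cofactor.d' Qd)
        even = ∣m+n∣m⇒∣n (subst (2 ∣_) qd eg) evr
        lt : deg (Cofactor.d' Qd) < (N ∸ Dh) + (N ∸ Dh)
        lt = +-cancelˡ-< (Dh + Dh) _ _
            (subst (λ z → (Dh + Dh) + deg (Cofactor.d' Qd) < z) (sym ([d+d]+[n∸d+n∸d]≡n+n Dh N le))
            (subst (λ z → z + deg (Cofactor.d' Qd) < N + N) lur (subst (_< N + N) qd lg)))

    length-pow-r : ∀ j → length (pow p r j) ≡ suc (j * length ur)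
    length-pow-r j = length-pow ur j cr

    deg-pow : ∀ j → deg (pow p r j) ≡ j * Dh + j * Dh
    deg-pow j = trans (cong (_∸ 1) (length-pow-r j)) (trans (cong (j *_) lur) (*-distribˡ-+ j Dh Dh))

    r∣ₚpow : ∀ j → 1 ≤ j → r ∣ₚ pow p r j
    r∣ₚpow (suc j) _ = pow p r j , ≈-sym (pow-suc r j)

    φ-pow : ∀ j → 1 ≤ j → Phi p (pow p r j) (p ^ (j * Dh) ∸ p ^ (j * Dh ∸ Dh))
    φ-pow j j1 with HasCard-split (HasCard-EvenSR N) (λ g → monic-∣ₚ? ur g cr)
      where N = j * Dh
    ... | n₁ , n₂ , h1 , h2 , e = subst (Phi p (pow p r j)) n₂≡ (HasCard-⇔ h2 fwd bwd)
      where
      N = j * Dh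
      le : Dh ≤ N
      le = subst (_≤ j * Dh) (*-identityˡ Dh) (*-monoˡ-≤ Dh j1)
      n₁≡ : n₁ ≡ p ^ (N ∸ Dh) ∸ 1
      n₁≡ = HasCard-unique h1 (HasCard-EvenSR-multiples N le)
      1≤p^ : ∀ n → 1 ≤ p ^ n
      1≤p^ n = m^n>0 p n
      n₂≡ : n₂ ≡ p ^ N ∸ p ^ (N ∸ Dh)
      n₂≡ = trans (sym (m+n∸m≡n n₁ n₂))
          (trans (cong₂ _∸_ e n₁≡) ([a∸1]∸[b∸1]≡a∸b (p ^ N) (p ^ (N ∸ Dh)) (1≤p^ N) (1≤p^ (N ∸ Dh))))
        where
        [a∸1]∸[b∸1]≡a∸b : ∀ a b → 1 ≤ a → 1 ≤ b → (a ∸ 1) ∸ (b ∸ 1) ≡ a ∸ b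
        [a∸1]∸[b∸1]≡a∸b (suc a) (suc b) _ _ = refl
      fwd : ∀ g → EvenSR N g × ¬ r ∣ₚ g → InK p (pow p r j) g
      fwd g (((cg , ng , sg) , eg , lg) , nd) = cg , (≉0⇒≢[] ng , sg) , eg ,
          subst (deg g <_) (sym (deg-pow j)) lg , cop
        where
        cop : Coprime p g (pow p r j)
        cop d cd dg' dpw with unit-or-absorbs j d (Divides⇒∣ₚ {d} {pow p r j} dpw (pow-canonical r j))
        ... | inj₁ s1 = trans (sym (∥∥-canonical cd)) s1
        ... | inj₂ f = ⊥-elim (nd (f g (cg , ng , sg) eg (Divides⇒∣ₚ {d} {g} dg' cg)))
      bwd : ∀ g → InK p (pow p r j) g → EvenSR N g × ¬ r ∣ₚ g
      bwd g (cg , (ne , sg) , eg , lg , cop) =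
          ((cg , ≢[]⇒≉0 cg ne , sg) , eg , subst (deg g <_) (deg-pow j) lg) ,
          λ dv → lr (cop r cr (∣ₚ⇒Divides {r} {g} dv cg)
          (∣ₚ⇒Divides {r} {pow p r j} (r∣ₚpow j j1) (pow-canonical r j)))
        where
        lr : length r ≡ 1 → ⊥
        lr e = helper (subst (1 ≤_) (suc-injective
            (trans (sym (trans (sym (∥∥-canonical cr)) (∥∥-canonical-snoc ur 1 cr))) e)) posr)
          where
          helper : 1 ≤ 0 → ⊥
          helper ()

    pow≢[] : ∀ i → ¬ pow p r i ≡ []
    pow≢[] i e = 0≢1+n (trans (sym (cong length e)) (length-pow-r i))

    deg-pow′ : ∀ i → deg (pow p r i) ≡ i * length ur
    deg-pow′ i = cong (_∸ 1) (length-pow-r i)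

    SRDiv-pow : ∀ k i → i ≤ k → SRDiv p (pow p r k) (i * length ur) (pow p r i)
    SRDiv-pow k i le = pow-canonical r i , MonicForm⇒Monic (pow-MonicForm r i cr (ur , refl)) ,
        (pow≢[] i , pow-selfRecip r i cr sr) ,
      ∣ₚ⇒Divides {pow p r i} {pow p r k}
          (pow p r (k ∸ i) , ≈-sym (subst (λ z → pow p r z ≈ mulRaw (pow p r i) (pow p r (k ∸ i)))
          (m+[n∸m]≡n le) (pow-+ r i (k ∸ i)))) (pow-canonical r k) ,
      deg-pow′ i

    SRDiv⇒pow : ∀ k t d → 2 ∣ t → SRDiv p (pow p r k) t d
        → Σ ℕ λ i → i ≤ k × d ≡ pow p r i × t ≡ i * length ur
    SRDiv⇒pow k t d even (cd , md , (ne , sd) , dv , degd) with SRDivisor⇒pow k d (cd , ≢[]⇒≉0 cd ne , sd)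
        (Monic⇒MonicForm md) (subst (2 ∣_) (sym degd) even)
        (Divides⇒∣ₚ {d} {pow p r k} dv (pow-canonical r k))
    ... | i , le , refl = i , le , refl , trans (sym degd) (deg-pow′ i)

    instance
      nzur : NonZero (length ur)
      nzur = >-nonZero posr

    N-pow : ∀ k j → 1 ≤ j → j ≤ k → IsN p (pow p r k) (j * length ur) (p ^ (j * Dh) ∸ p ^ (j * Dh ∸ Dh))
    N-pow k j j1 jk = N-even (*-mono-≤ j1 posr) even (pow p r j ∷ []) (All.[] AllPairs.∷ AllPairs.[]) mem comp
        (v ∷ []) (φ-pow j j1 Pointwise.∷ Pointwise.[]) (+-identityʳ v)
      where
      v = p ^ (j * Dh) ∸ p ^ (j * Dh ∸ Dh)
      even : 2 ∣ j * length ur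
      even = ∣n⇒∣m*n j evr
      mem : ∀ d → d ∈ (pow p r j ∷ []) → SRDiv p (pow p r k) (j * length ur) d
      mem d (here refl) = SRDiv-pow k j jk
      comp : ∀ d → SRDiv p (pow p r k) (j * length ur) d → d ∈ (pow p r j ∷ [])
      comp d s with SRDiv⇒pow k (j * length ur) d even s
      ... | i , le , refl , e = here (cong (pow p r) (sym (*-cancelʳ-≡ j i (length ur) e)))

    N-off-lattice : ∀ k t → (∀ i → i ≤ k → ¬ t ≡ i * length ur) → IsN p (pow p r k) t 0
    N-off-lattice k t h with 2 ∣? t
    ... | no nev = N-odd nev
    ... | yes even = N-even (n≢0⇒n>0 (λ e → h 0 z≤n e)) even [] AllPairs.[] (λ d ()) comp [] Pointwise.[] refl
      where
      comp : ∀ d → SRDiv p (pow p r k) t d → d ∈ []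
      comp d s with SRDiv⇒pow k t d even s
      ... | i , le , _ , e = ⊥-elim (h i le e)

  -- Evaluation and the squares (x ± 1)²

  infix 4 _≡ₘ_
  _≡ₘ_ : ℕ → ℕ → Set
  a ≡ₘ b = a % p ≡ b % p

  +ₘ : ∀ {a a' b b'} → a ≡ₘ a' → b ≡ₘ b' → a + b ≡ₘ a' + b'
  +ₘ {a} {a'} {b} {b'} e1 e2 = trans (%-distribˡ-+ a b p)
      (trans (cong₂ (λ x y → (x + y) % p) e1 e2) (sym (%-distribˡ-+ a' b' p)))

  *ₘ : ∀ {a a' b b'} → a ≡ₘ a' → b ≡ₘ b' → a * b ≡ₘ a' * b'
  *ₘ {a} {a'} {b} {b'} e1 e2 = trans (%-distribˡ-* a b p)
      (trans (cong₂ (λ x y → (x * y) % p) e1 e2) (sym (%-distribˡ-* a' b' p)))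

  ≡→ₘ : ∀ {a b} → a ≡ b → a ≡ₘ b
  ≡→ₘ e = cong (_% p) e

  eval : ℕ → List ℕ → ℕ
  eval α [] = 0
  eval α (c ∷ f) = c + α * eval α f

  eval-add : ∀ α f g → eval α (addRaw f g) ≡ eval α f + eval α g
  eval-add α [] g = refl
  eval-add α (a ∷ f) [] = sym (+-identityʳ _)
  eval-add α (a ∷ f) (b ∷ g) rewrite eval-add α f g =
      rearrange a b (α * eval α f) (α * eval α g) (*-distribˡ-+ α (eval α f) (eval α g))
    where
    rearrange : ∀ a b x y → α * (eval α f + eval α g) ≡ x + y
        → a + b + α * (eval α f + eval α g) ≡ a + x + (b + y)
    rearrange a b x y e rewrite e = trans (+-assoc a b (x + y))
        (trans (cong (a +_) (trans (sym (+-assoc b x y)) (trans (cong (_+ y) (+-comm b x)) (+-assoc x b y))))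
        (sym (+-assoc a x (b + y))))

  eval-scale : ∀ α c f → eval α (scale c f) ≡ c * eval α f
  eval-scale α c [] = sym (*-zeroʳ c)
  eval-scale α c (a ∷ f) rewrite eval-scale α c f =
      trans (cong (c * a +_) (trans (sym (*-assoc α c (eval α f)))
      (trans (cong (_* eval α f) (*-comm α c)) (*-assoc c α (eval α f)))))
      (sym (*-distribˡ-+ c a (α * eval α f)))

  eval-mul : ∀ α f g → eval α (mulRaw f g) ≡ eval α f * eval α g
  eval-mul α [] g = refl
  eval-mul α (a ∷ f) g = trans (eval-add α (scale a g) (0 ∷ mulRaw f g))
      (trans (cong₂ _+_ (eval-scale α a g) (cong (α *_) (eval-mul α f g)))
      (trans (cong (a * eval α g +_) (sym (*-assoc α (eval α f) (eval α g))))
      (sym (*-distribʳ-+ (eval α g) a (α * eval α f)))))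

  eval-consT : ∀ α x u → eval α (consT x u) ≡ₘ eval α (x ∷ u)
  eval-consT α zero [] = ≡→ₘ (sym (*-zeroʳ α))
  eval-consT α (suc x) [] = refl
  eval-consT α zero (y ∷ u) = refl
  eval-consT α (suc x) (y ∷ u) = refl

  eval-norm : ∀ α f → eval α (norm p f) ≡ₘ eval α f
  eval-norm α [] = refl
  eval-norm α (c ∷ f) = trans (eval-consT α (c % p) (norm p f))
      (+ₘ {c % p} {c} (m%n%n≡m%n c p) (*ₘ {α} {α} refl (eval-norm α f)))

  eval-cong : ∀ α {f g} → f ≈ g → eval α f ≡ₘ eval α g
  eval-cong α {f} {g} (mk e) = trans (sym (eval-norm α f))
      (trans (cong (λ z → eval α z % p) e) (eval-norm α g))

  eval-snoc : ∀ α u b → eval α (u ++ b ∷ []) ≡ eval α u + b * α ^ length u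
  eval-snoc α [] b = trans (cong (b +_) (*-zeroʳ α)) (trans (+-identityʳ b) (sym (*-identityʳ b)))
  eval-snoc α (c ∷ u) b rewrite eval-snoc α u b =
      trans (cong (c +_) (*-distribˡ-+ α (eval α u) (b * α ^ length u)))
      (trans (sym (+-assoc c _ _)) (cong (c + α * eval α u +_)
      (trans (sym (*-assoc α b _)) (trans (cong (_* α ^ length u) (*-comm α b)) (*-assoc b α _)))))

  factor-theorem : ∀ a0 α → eval α (a0 ∷ 1 ∷ []) ≡ₘ 0 → ∀ h → eval α h ≡ₘ 0 → (a0 ∷ 1 ∷ []) ∣ₚ h
  factor-theorem a0 α hq h hh with divide-monic (a0 ∷ []) h
  ... | Q , R , e , le with IsZero? R
  ... | yes zR = Q , ≈-sym (e ∙ add-IsZeroʳ {mulRaw (a0 ∷ 1 ∷ []) Q} zR)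
  ... | no nR with unit-constant R (≤-antisym le (∥∥-pos R nR))
  ... | c , eR , nc = ⊥-elim (nc cz)
    where
    qq = a0 ∷ 1 ∷ []
    cz : c % p ≡ 0
    cz = trans (sym (≡→ₘ (trans (cong (c +_) (*-zeroʳ α)) (+-identityʳ c))))
         (trans (sym (eval-cong α eR))
         (trans (≡→ₘ {eval α R} {0 + eval α R} refl)
         (trans (+ₘ {0} {eval α qq * eval α Q} {eval α R} {eval α R}
             (sym (*ₘ {eval α qq} {0} {eval α Q} {eval α Q} hq refl)) refl)
         (trans (≡→ₘ (sym (trans (eval-add α (mulRaw qq Q) R) (cong (_+ eval α R) (eval-mul α qq Q)))))
         (trans (sym (eval-cong α e)) hh)))))

  SameCoeffs-snoc⁻¹ : ∀ x y a b → length x ≡ length y → SameCoeffs (x ++ a ∷ []) (y ++ b ∷ [])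
      → SameCoeffs x y × a ≡ₘ b
  SameCoeffs-snoc⁻¹ [] [] a b l (same∷ e same[]) = same[] , e
  SameCoeffs-snoc⁻¹ [] (y ∷ ys) a b () xy
  SameCoeffs-snoc⁻¹ (x ∷ xs) [] a b () xy
  SameCoeffs-snoc⁻¹ (x ∷ xs) (y ∷ ys) a b l (same∷ e xy) = let (p' , e') = SameCoeffs-snoc⁻¹ xs ys a b (suc-injective l) xy in same∷ e p' , e'

  ^-even≡ₘ1 : ∀ α → (α * α) ≡ₘ 1 → ∀ n → α ^ (n + n) ≡ₘ 1
  ^-even≡ₘ1 α hα zero = refl
  ^-even≡ₘ1 α hα (suc n) = trans
      (≡→ₘ (trans (cong (λ z → α * α ^ z) (+-suc n n)) (sym (*-assoc α α (α ^ (n + n))))))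
    (*ₘ {α * α} {1} {α ^ (n + n)} {1} hα (^-even≡ₘ1 α hα n))

  -- The outer coefficients a and b ≡ κ·a contribute a + b·α^(2m+1) ≡ a·(1 + κα) ≡ 0, as α² ≡ 1.
  eval-twistedPalindrome : ∀ α κ → (1 + κ * α) ≡ₘ 0 → (α * α) ≡ₘ 1 → ∀ m h → length h ≡ m + m
      → SameCoeffs (reverse h) (scale κ h) → eval α h ≡ₘ 0
  eval-twistedPalindrome α κ 1+κα≡0 α²≡1 zero [] l xy = refl
  eval-twistedPalindrome α κ 1+κα≡0 α²≡1 (suc m) [] () xy
  eval-twistedPalindrome α κ 1+κα≡0 α²≡1 (suc m) (a ∷ f₁) l xy with initLast f₁
  ... | [] = ⊥-elim (0≢1+n (trans (suc-injective l) (+-suc m m)))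
  ... | mid ∷ʳ′ b = goal
    where
    lmid : length mid ≡ m + m
    lmid = suc-injective (trans (trans (+-comm 1 (length mid)) (sym (length-++ mid)))
        (trans (suc-injective l) (+-suc m m)))
    e1 : reverse (a ∷ mid ++ b ∷ []) ≡ b ∷ (reverse mid ++ a ∷ [])
    e1 = trans (unfold-reverse a (mid ++ b ∷ [])) (cong (_++ a ∷ []) (reverse-++ mid (b ∷ [])))
    e2 : scale κ (a ∷ mid ++ b ∷ []) ≡ κ * a ∷ (scale κ mid ++ κ * b ∷ [])
    e2 = cong (κ * a ∷_) (map-++ (κ *_) mid (b ∷ []))
    p' : SameCoeffs (b ∷ (reverse mid ++ a ∷ [])) (κ * a ∷ (scale κ mid ++ κ * b ∷ []))
    p' = subst₂ SameCoeffs e1 e2 xy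
    ba : b ≡ₘ κ * a
    ba with p'
    ... | same∷ e _ = e
    rest : SameCoeffs (reverse mid ++ a ∷ []) (scale κ mid ++ κ * b ∷ [])
    rest with p'
    ... | same∷ _ r = r
    inner = SameCoeffs-snoc⁻¹ (reverse mid) (scale κ mid) a (κ * b)
        (trans (length-reverse mid) (sym (length-map (κ *_) mid))) rest
    ih : eval α mid ≡ₘ 0
    ih = eval-twistedPalindrome α κ 1+κα≡0 α²≡1 m mid lmid (proj₁ inner)
    ap : α ^ length mid ≡ₘ 1
    ap = trans (cong (λ z → α ^ z % p) lmid) (^-even≡ₘ1 α α²≡1 m)
    goal : eval α (a ∷ mid ++ b ∷ []) ≡ₘ 0
    goal = trans (≡→ₘ (cong (λ z → a + α * z) (eval-snoc α mid b)))
      (trans (+ₘ {a} {a} {α * (eval α mid + b * α ^ length mid)} {α * (0 + b * 1)} refl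
          (*ₘ {α} {α} refl (+ₘ {eval α mid} {0} {b * α ^ length mid} {b * 1} ih
          (*ₘ {b} {b} {α ^ length mid} {1} refl ap))))
      (trans (≡→ₘ (cong (λ z → a + α * z) (*-identityʳ b)))
      (trans (+ₘ {a} {a} {α * b} {α * (κ * a)} refl (*ₘ {α} {α} refl ba))
      (trans (≡→ₘ (trans (cong₂ _+_ (sym (*-identityʳ a))
          (trans (sym (*-assoc α κ a)) (trans (*-comm (α * κ) a) (cong (a *_) (*-comm α κ)))))
          (sym (*-distribˡ-+ a 1 (κ * α)))))
      (trans (*ₘ {a} {a} {1 + κ * α} {0} refl 1+κα≡0) (≡→ₘ (*-zeroʳ a)))))))

  one≉0 : ¬ IsZero (1 ∷ [])
  one≉0 (mk ())

  divisor-of-pow-is-unit : ∀ r e → (∀ X → e ∣ₚ mulRaw r X → e ∣ₚ X) → ∀ j → e ∣ₚ pow p r j → ∥ e ∥ ≡ 1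
  divisor-of-pow-is-unit r e c zero dv = ≤-antisym (∣ₚ⇒∥∥≤ e (1 ∷ []) one≉0 dv) (∥∥-pos e ne)
    where
    ne : ¬ IsZero e
    ne z = one≉0 (≈-sym (proj₂ dv) ∙ IsZero-mulˡ e (proj₁ dv) z)
  divisor-of-pow-is-unit r e c (suc j) dv =
      divisor-of-pow-is-unit r e c j (c (pow p r j) (∣ₚ-respʳ {e} (pow-suc r j) dv))

  mkSRPrime : ∀ ur → Canonical p (ur ++ 1 ∷ []) → recip p (ur ++ 1 ∷ []) ≡ ur ++ 1 ∷ []
      → 2 ∣ length ur → 1 ≤ length ur →
    (T : List ℕ → Set) →
    (∀ e → (∀ X → e ∣ₚ mulRaw (ur ++ 1 ∷ []) X → e ∣ₚ X) ⊎ T e) →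
    (∀ e → T e → ∀ g → CanonicalSR g → 2 ∣ deg g → e ∣ₚ g → (ur ++ 1 ∷ []) ∣ₚ g) → SRPrime ur
  mkSRPrime ur cr sr evr posr T dichotomy absorbs =
      record { cr = cr ; sr = sr ; evr = evr ; posr = posr ; divides-or-cancels = divides-or-cancels′ ; unit-or-absorbs = unit-or-absorbs′ }
    where
    divides-or-cancels′ : ∀ d → CanonicalSR d → 2 ∣ deg d → (ur ++ 1 ∷ []) ∣ₚ d ⊎ (∀ X → d ∣ₚ mulRaw (ur ++ 1 ∷ []) X → d ∣ₚ X)
    divides-or-cancels′ d srd even with dichotomy d
    ... | inj₁ c = inj₂ c
    ... | inj₂ t = inj₁ (absorbs d t d srd even (∣ₚ-refl d))
    unit-or-absorbs′ : ∀ j e → e ∣ₚ pow p (ur ++ 1 ∷ []) j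
        → ∥ e ∥ ≡ 1 ⊎ (∀ g → CanonicalSR g → 2 ∣ deg g → e ∣ₚ g → (ur ++ 1 ∷ []) ∣ₚ g)
    unit-or-absorbs′ j e dv with dichotomy e
    ... | inj₁ c = inj₁ (divisor-of-pow-is-unit (ur ++ 1 ∷ []) e c j dv)
    ... | inj₂ t = inj₂ (absorbs e t)

  degree1⇒IsIrreducible : ∀ f → ∥ f ∥ ≡ 2 → IsIrreducible f
  degree1⇒IsIrreducible f e = ≤-reflexive (sym e) , λ a b ab → factors a b ab
    where
    factors : ∀ a b → mulRaw a b ≈ f → ∥ a ∥ ≡ 1 ⊎ ∥ b ∥ ≡ 1
    factors a b ab with IsZero? a | IsZero? b
    ... | yes za | _ = ⊥-elim (0≢1+n (trans (sym (IsZero⇒∥∥≡0 (≈-sym ab ∙ IsZero-mulˡ a b za))) e))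
    ... | no _ | yes zb = ⊥-elim (0≢1+n (trans (sym (IsZero⇒∥∥≡0 (≈-sym ab ∙ IsZero-mulʳ a b zb))) e))
    ... | no na | no nb = cases ∥ a ∥ ∥ b ∥ refl refl
        (trans (sym (∥∥-mul a b na nb)) (cong suc (trans (∥∥-cong ab) e))) (∥∥-pos a na) (∥∥-pos b nb)
      where
      cases : ∀ x y → ∥ a ∥ ≡ x → ∥ b ∥ ≡ y → x + y ≡ 3 → 1 ≤ x → 1 ≤ y → ∥ a ∥ ≡ 1 ⊎ ∥ b ∥ ≡ 1
      cases 1 y ea eb s _ _ = inj₁ ea
      cases 2 1 ea eb s _ _ = inj₂ eb
      cases 2 (suc (suc y)) ea eb () _ _
      cases (suc (suc (suc x))) (suc y) ea eb s _ _ =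
          ⊥-elim (0≢1+n (sym (trans (sym (+-suc x y)) (suc-injective (suc-injective (suc-injective s))))))
      cases 0 y ea eb s () _
      cases 2 0 ea eb s _ ()
      cases (suc (suc (suc x))) 0 ea eb s _ ()

  irreducible⇒SRPrime : ∀ ur → Canonical p (ur ++ 1 ∷ []) → recip p (ur ++ 1 ∷ []) ≡ ur ++ 1 ∷ []
      → 2 ∣ length ur → IsIrreducible (ur ++ 1 ∷ []) → SRPrime ur
  irreducible⇒SRPrime ur cr sr evr irr =
      mkSRPrime ur cr sr evr posr ((ur ++ 1 ∷ []) ∣ₚ_) dichotomy (λ e t g _ _ d → ∣ₚ-trans {ur ++ 1 ∷ []} t d)
    where
    open Euclid ur cr irr
    posr : 1 ≤ length ur
    posr = ≤-pred (≤-trans (proj₁ irr) (≤-reflexive (∥∥-canonical-snoc ur 1 cr)))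
    dichotomy : ∀ e → (∀ X → e ∣ₚ mulRaw (ur ++ 1 ∷ []) X → e ∣ₚ X) ⊎ (ur ++ 1 ∷ []) ∣ₚ e
    dichotomy e with monic-∣ₚ? ur e cr
    ... | yes d = inj₂ d
    ... | no nd = inj₁ (λ X → coprime-cancel e X nd)

  module SquareOfLinear (a0 κ α : ℕ) (cq : Canonical p (a0 ∷ 1 ∷ [])) (ℓ[α]≡0 : eval α (a0 ∷ 1 ∷ []) ≡ₘ 0)
      (1+κα≡0 : (1 + κ * α) ≡ₘ 0)
                (α²≡1 : (α * α) ≡ₘ 1) (κ²≡1 : (κ * κ) ≡ₘ 1)
                    (ℓ*≈κℓ : recip p (a0 ∷ 1 ∷ []) ≈ scale κ (a0 ∷ 1 ∷ [])) where
    ℓ = a0 ∷ 1 ∷ []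
    ℓ² = pow p ℓ 2

    ℓ≉0 : ¬ IsZero ℓ
    ℓ≉0 = canonical-∷-≉0 cq

    ℓ-irreducible : IsIrreducible ℓ
    ℓ-irreducible = degree1⇒IsIrreducible ℓ (∥∥-canonical cq)

    open Euclid (a0 ∷ []) cq ℓ-irreducible

    ℓ²≈ℓ·ℓ : ℓ² ≈ mulRaw ℓ ℓ
    ℓ²≈ℓ·ℓ = pow-suc ℓ 1 ∙ mul-cong {ℓ} ≈-refl (pow-suc ℓ 0 ∙ mul-comm ℓ (1 ∷ []) ∙ mul-identityˡ ℓ)

    ℓ²-monic : MonicForm ℓ²
    ℓ²-monic = pow-MonicForm ℓ 2 cq ((a0 ∷ []) , refl)
    us = proj₁ ℓ²-monic
    ℓ²≡ : ℓ² ≡ us ++ 1 ∷ []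
    ℓ²≡ = proj₂ ℓ²-monic

    ℓ²-selfRecip : recip p ℓ² ≡ ℓ²
    ℓ²-selfRecip = canonical-≈⇒≡ (recip-canonical ℓ²) (pow-canonical ℓ 2)
      (≡→≈ (recip-mul ℓ (pow p ℓ 1) cq (pow-canonical ℓ 1)) ∙ norm≈ _ ∙
       mul-cong {recip p ℓ} {scale κ ℓ} ℓ*≈κℓ
           (≡→≈ (recip-mul ℓ (1 ∷ []) cq refl) ∙ norm≈ _
           ∙ mul-cong {recip p ℓ} {scale κ ℓ} {recip p (1 ∷ [])} {1 ∷ []} ℓ*≈κℓ ≈-refl) ∙
       mul-scaleˡ κ ℓ (mulRaw (scale κ ℓ) (1 ∷ []))
           ∙ scale-cong {κ} {κ} refl (mul-cong {ℓ} ≈-refl (mul-scaleˡ κ ℓ (1 ∷ []))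
           ∙ mul-scaleʳ κ ℓ (mulRaw ℓ (1 ∷ []))) ∙
       ≡→≈ (scale-scale κ κ _) ∙ scale-cong {κ * κ} {1} κ²≡1 ≈-refl ∙ ≡→≈ (scale-one _)
           ∙ mul-cong {ℓ} ≈-refl (mul-comm ℓ (1 ∷ []) ∙ mul-identityˡ ℓ) ∙ ≈-sym ℓ²≈ℓ·ℓ)

    length-us : length us ≡ 2
    length-us = suc-injective (trans (trans (+-comm 1 (length us)) (sym (length-++ us)))
        (trans (cong length (sym ℓ²≡)) (length-pow (a0 ∷ []) 2 cq)))

    -- g = ℓ·h with h* ≡ κ·h of odd degree, so h(α) ≡ 0 and ℓ divides h as well.
    ℓ∣⇒ℓ²∣ : ∀ g → CanonicalSR g → 2 ∣ deg g → ℓ ∣ₚ g → ℓ² ∣ₚ g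
    ℓ∣⇒ℓ²∣ g (cg , ng , sg) (divides m em) (h , e) = h'' , mul-cong ℓ²≈ℓ·ℓ (≈-refl {h''}) ∙ mul-assoc ℓ ℓ h''
        ∙ mul-cong {ℓ} ≈-refl e'' ∙ eg
      where
      h' = norm p h
      ch' : Canonical p h'
      ch' = norm-idem h
      eg : mulRaw ℓ h' ≈ g
      eg = ≈-sym (mul-normʳ ℓ h) ∙ e
      nh' : ¬ IsZero h'
      nh' z = ng (≈-sym eg ∙ IsZero-mulʳ ℓ h' z)
      egn : g ≡ norm p (mulRaw ℓ h')
      egn = sym (trans (un eg) cg)
      rcg : recip p g ≡ norm p (mulRaw (recip p ℓ) (recip p h'))
      rcg = trans (cong (recip p) egn) (recip-mul ℓ h' cq ch')
      c1 : mulRaw ℓ h' ≈ mulRaw ℓ (scale κ (recip p h'))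
      c1 = eg ∙ ≡→≈ (sym sg) ∙ ≡→≈ rcg ∙ norm≈ _ ∙ mul-cong ℓ*≈κℓ (≈-refl {recip p h'})
          ∙ mul-scaleˡ κ ℓ (recip p h') ∙ ≈-sym (mul-scaleʳ κ ℓ (recip p h'))
      c2 : h' ≈ scale κ (recip p h')
      c2 = mul-cancelˡ ℓ h' (scale κ (recip p h')) ℓ≉0 c1
      rch : recip p h' ≈ scale κ h'
      rch = ≈-sym (scale-cong {κ} {κ} refl c2 ∙ ≡→≈ (scale-scale κ κ (recip p h'))
          ∙ scale-cong {κ * κ} {1} κ²≡1 ≈-refl ∙ ≡→≈ (scale-one (recip p h')))
      pwr : SameCoeffs (reverse h') (scale κ h')
      pwr = ≈∧length⇒SameCoeffs (reverse h') (scale κ h') (≈-sym (norm≈ (reverse h')) ∙ rch)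
          (trans (length-reverse h') (sym (length-map (κ *_) h')))
      lg : length g ≡ suc (length h')
      lg = trans (cong length egn) (suc-injective
          (trans (∥∥-mul ℓ h' ℓ≉0 nh') (cong₂ _+_ (∥∥-canonical cq) (∥∥-canonical ch'))))
      lh : length h' ≡ m + m
      lh = trans (sym (cong (_∸ 1) lg)) (trans em (n*2≡n+n m))
      dq = factor-theorem a0 α ℓ[α]≡0 h' (eval-twistedPalindrome α κ 1+κα≡0 α²≡1 m h' lh pwr)
      h'' = proj₁ dq
      e'' : mulRaw ℓ h'' ≈ h'
      e'' = proj₂ dq

    srPrime : SRPrime us
    srPrime = mkSRPrime us (subst (Canonical p) ℓ²≡ (pow-canonical ℓ 2))
        (subst (λ z → recip p z ≡ z) ℓ²≡ ℓ²-selfRecip) (divides 1 length-us)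
        (≤-trans (s≤s z≤n) (≤-reflexive (sym length-us)))
      (ℓ ∣ₚ_) dichotomy (λ e t g srg evg d → subst (λ z → z ∣ₚ g) ℓ²≡
          (ℓ∣⇒ℓ²∣ g srg evg (∣ₚ-trans {ℓ} t d)))
      where
      dichotomy : ∀ e → (∀ X → e ∣ₚ mulRaw (us ++ 1 ∷ []) X → e ∣ₚ X) ⊎ ℓ ∣ₚ e
      dichotomy e with monic-∣ₚ? (a0 ∷ []) e cq
      ... | yes d = inj₂ d
      ... | no nd = inj₁ (λ X d → coprime-cancel e X nd
          (coprime-cancel e (mulRaw ℓ X) nd
          (∣ₚ-respʳ {e} (mul-cong (≈-sym (≡→≈ ℓ²≡) ∙ ℓ²≈ℓ·ℓ) (≈-refl {X}) ∙ mul-assoc ℓ ℓ X) d)))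

  -- Conjugate pairs g·g*

  +-≤-equal : ∀ x X y Y → x ≤ X → y ≤ Y → x + y ≡ X + Y → x ≡ X
  +-≤-equal x X y Y lx ly e with m≤n⇒m<n∨m≡n lx
  ... | inj₂ eq = eq
  ... | inj₁ lt = ⊥-elim (<-irrefl e (+-mono-<-≤ lt ly))

  -- Reversing a factorisation cannot shrink either factor, since the sizes still add up.
  recip-IsIrreducible : ∀ c f → Canonical p (c ∷ f) → c % p ≢ 0 → IsIrreducible (c ∷ f)
      → IsIrreducible (recip p (c ∷ f))
  recip-IsIrreducible c f cg nc (2≤g , irreducible) = subst (2 ≤_) (sym ∥g*∥) 2≤g , factors
    where
    g = c ∷ f
    g* = recip p g
    ∥g*∥ : ∥ g* ∥ ≡ ∥ g ∥
    ∥g*∥ = trans (cong length (norm-idem (reverse g))) (trans (∥reverse∥ c f nc) (sym (∥∥-canonical cg)))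
    g*≉0 : ¬ IsZero g*
    g*≉0 z = canonical-∷-≉0 cg (∥∥≡0⇒IsZero g (trans (sym ∥g*∥) (IsZero⇒∥∥≡0 z)))
    factors : ∀ a b → mulRaw a b ≈ g* → ∥ a ∥ ≡ 1 ⊎ ∥ b ∥ ≡ 1
    factors a b ab = transfer (irreducible (recip p a') (recip p b') a*b*≈g)
      where
      a' = norm p a
      b' = norm p b
      a'b'≈g* : mulRaw a' b' ≈ g*
      a'b'≈g* = ≈-sym (mul-normˡ a b') ∙ ≈-sym (mul-normʳ a b) ∙ ab
      a*b*≈g : mulRaw (recip p a') (recip p b') ≈ g
      a*b*≈g = ≈-sym (norm≈ _) ∙ ≡→≈ (sym (recip-mul a' b' (norm-idem a) (norm-idem b)))
        ∙ cong-≈ (recip p) (canonical-≈⇒≡ (norm-idem (mulRaw a' b')) (recip-canonical g)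
            (norm≈ (mulRaw a' b') ∙ a'b'≈g*))
        ∙ ≡→≈ (recip-involutive c f cg nc)
      a*≉0 : ¬ IsZero (recip p a')
      a*≉0 z = canonical-∷-≉0 cg (≈-sym a*b*≈g ∙ IsZero-mulˡ (recip p a') (recip p b') z)
      b*≉0 : ¬ IsZero (recip p b')
      b*≉0 z = canonical-∷-≉0 cg (≈-sym a*b*≈g ∙ IsZero-mulʳ (recip p a') (recip p b') z)
      a'≉0 : ¬ IsZero a'
      a'≉0 z = g*≉0 (≈-sym a'b'≈g* ∙ IsZero-mulˡ a' b' z)
      b'≉0 : ¬ IsZero b'
      b'≉0 z = g*≉0 (≈-sym a'b'≈g* ∙ IsZero-mulʳ a' b' z)
      sizes : ∥ recip p a' ∥ + ∥ recip p b' ∥ ≡ ∥ a' ∥ + ∥ b' ∥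
      sizes = trans (sym (∥∥-mul (recip p a') (recip p b') a*≉0 b*≉0))
        (trans (cong suc (trans (∥∥-cong a*b*≈g) (trans (sym ∥g*∥) (sym (∥∥-cong a'b'≈g*)))))
            (∥∥-mul a' b' a'≉0 b'≉0))
      a*≤a' : ∥ recip p a' ∥ ≤ ∥ a' ∥
      a*≤a' = ≤-trans (∥recip∥≤length a') (≤-reflexive (sym (∥∥-canonical (norm-idem a))))
      b*≤b' : ∥ recip p b' ∥ ≤ ∥ b' ∥
      b*≤b' = ≤-trans (∥recip∥≤length b') (≤-reflexive (sym (∥∥-canonical (norm-idem b))))
      transfer : ∥ recip p a' ∥ ≡ 1 ⊎ ∥ recip p b' ∥ ≡ 1 → ∥ a ∥ ≡ 1 ⊎ ∥ b ∥ ≡ 1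
      transfer (inj₁ e) = inj₁ (trans (sym (cong length (norm-idem a)))
          (trans (sym (+-≤-equal _ _ _ _ a*≤a' b*≤b' sizes)) e))
      transfer (inj₂ e) = inj₂ (trans (sym (cong length (norm-idem b)))
        (trans (sym (+-≤-equal _ _ _ _ b*≤b' a*≤a'
            (trans (+-comm ∥ recip p b' ∥ ∥ recip p a' ∥) (trans sizes (+-comm ∥ a' ∥ ∥ b' ∥))))) e))

  ∣ₚ-recip : ∀ x g' → Canonical p x → Canonical p g' → recip p g' ≡ g' → x ∣ₚ g' → (recip p x) ∣ₚ g'
  ∣ₚ-recip x g' cx cg sg (h , e) = recip p (norm p h) ,
      mk (trans (sym (recip-mul x (norm p h) cx (norm-idem h)))
      (trans (cong (recip p) (trans (sym (un (mul-normʳ x h))) (trans (un e) cg))) (trans sg (sym cg))))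

  scale-inverse : ∀ c X → c % p ≢ 0 → Σ ℕ λ c' → c' % p ≢ 0 × scale c' (scale c X) ≈ X
  scale-inverse c X nc with %-inverse c nc
  ... | c' , e = c' , nc' , ≡→≈ (scale-scale c' c X) ∙ scale-cong {c' * c} {1} e ≈-refl ∙ ≡→≈ (scale-one X)
    where
    nc' : c' % p ≢ 0
    nc' z = 0≢1+n (trans (sym (trans (%-distribˡ-* c' c p) (cong (λ x → (x * (c % p)) % p) z))) e)

  2∤1 : ¬ 2 ∣ 1
  2∤1 (divides zero ())
  2∤1 (divides (suc k) ())

  module ConjugatePair (ug : List ℕ) (cg : Canonical p (ug ++ 1 ∷ [])) (irg : IsIrreducible (ug ++ 1 ∷ []))
               (ncm : ¬ (Σ ℕ λ c → recip p (ug ++ 1 ∷ []) ≡ cmul p c (ug ++ 1 ∷ [])))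
               (u : ℕ) (u0 : 0 < u) (uP : u < p)
               (ur : List ℕ) (cr : Canonical p (ur ++ 1 ∷ []))
               (er : ur ++ 1 ∷ [] ≡ norm p (mulRaw (norm p (mulRaw (u ∷ []) (ug ++ 1 ∷ [])))
                   (recip p (ug ++ 1 ∷ []))))
               (evr : 2 ∣ length ur) where
    g = ug ++ 1 ∷ []
    gs = recip p g
    r = ur ++ 1 ∷ []

    nu : u % p ≢ 0
    nu z = <-irrefl (sym (trans (sym (m<n⇒m%n≡m uP)) z)) u0
    cu : Canonical p (u ∷ [])
    cu = canonical-constant u (m<n⇒m%n≡m uP) nu
    su : ∥ u ∷ [] ∥ ≡ 1
    su = ∥∥-canonical cu

    nZr : ¬ IsZero r
    nZr = canonical-snoc-≉0 ur 1 cr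
    nZg : ¬ IsZero g
    nZg = canonical-snoc-≉0 ug 1 cg
    sg2 : 2 ≤ ∥ g ∥
    sg2 = proj₁ irg

    r≈ : r ≈ mulRaw (mulRaw (u ∷ []) g) gs
    r≈ = ≡→≈ er ∙ norm≈ (mulRaw (norm p (mulRaw (u ∷ []) g)) gs)
        ∙ mul-cong (norm≈ (mulRaw (u ∷ []) g)) (≈-refl {gs})

    nZgs : ¬ IsZero gs
    nZgs z = nZr (r≈ ∙ IsZero-mulʳ (mulRaw (u ∷ []) g) gs z)

    hf : Σ ℕ λ c0 → Σ (List ℕ) λ g1 → g ≡ c0 ∷ g1
    hf = helper ug
      where
      helper : ∀ v → Σ ℕ λ c0 → Σ (List ℕ) λ g1 → v ++ 1 ∷ [] ≡ c0 ∷ g1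
      helper [] = 1 , [] , refl
      helper (x ∷ v) = x , v ++ 1 ∷ [] , refl
    c0 = proj₁ hf
    g1 = proj₁ (proj₂ hf)
    eg : g ≡ c0 ∷ g1
    eg = proj₂ (proj₂ hf)
    cg' : Canonical p (c0 ∷ g1)
    cg' = subst (Canonical p) eg cg

    -- If g(0) = 0 then g = x by irreducibility, and r = u·g·g* would have odd degree 1.
    nc0 : c0 % p ≢ 0
    nc0 z with proj₂ irg (0 ∷ 1 ∷ []) g1 xg
      where
      xg : mulRaw (0 ∷ 1 ∷ []) g1 ≈ g
      xg = add-cong (IsZero-scale0 g1) (≈-∷ {0} {0} refl (mul-identityˡ g1))
          ∙ ≈-∷ {0} {c0} (sym z) ≈-refl ∙ ≡→≈ (sym eg)
    ... | inj₁ ()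
    ... | inj₂ s1 = 2∤1 (subst (2 ∣_) lur evr)
      where
      cg1 : Canonical p g1
      cg1 = proj₂ (canonical-∷⁻¹ c0 g1 cg')
      lg1 : length g1 ≡ 1
      lg1 = trans (sym (∥∥-canonical cg1)) s1
      sgs≤ : ∥ gs ∥ ≤ 1
      sgs≤ = ≤-trans (≤-reflexive (cong length
          (trans (norm-idem (reverse g))
          (trans (cong (λ z → norm p (reverse z)) eg)
          (trans (cong (norm p) (unfold-reverse c0 g1)) (un (snoc0-≈ (reverse g1) c0 z)))))))
               (≤-trans (length-norm (reverse g1)) (≤-reflexive (trans (length-reverse g1) lg1)))
      sgs : ∥ gs ∥ ≡ 1
      sgs = ≤-antisym sgs≤ (∥∥-pos gs nZgs)
      sg : ∥ g ∥ ≡ 2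
      sg = trans (∥∥-canonical cg) (trans (cong length eg) (cong suc lg1))
      nug : ¬ IsZero (mulRaw (u ∷ []) g)
      nug = mul-≉0 (u ∷ []) g (canonical-∷-≉0 cu) nZg
      sug : ∥ mulRaw (u ∷ []) g ∥ ≡ 2
      sug = suc-injective (trans (∥∥-mul (u ∷ []) g (canonical-∷-≉0 cu) nZg) (cong₂ _+_ su sg))
      sr2 : ∥ r ∥ ≡ 2
      sr2 = trans (∥∥-cong r≈) (suc-injective
          (trans (∥∥-mul (mulRaw (u ∷ []) g) gs nug nZgs) (cong₂ _+_ sug sgs)))
      lur : length ur ≡ 1
      lur = suc-injective (trans (sym (∥∥-canonical-snoc ur 1 cr)) sr2)

    rr : recip p gs ≡ g
    rr = subst (λ z → recip p (recip p z) ≡ z) (sym eg) (recip-involutive c0 g1 cg' nc0)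

    sgs : ∥ gs ∥ ≡ ∥ g ∥
    sgs = trans (cong length (norm-idem (reverse g)))
        (trans (cong (λ z → ∥ reverse z ∥) eg)
        (trans (∥reverse∥ c0 g1 nc0) (sym (trans (∥∥-canonical cg) (cong length eg)))))

    cgs : Canonical p gs
    cgs = recip-canonical g

    irgs : IsIrreducible gs
    irgs = subst (λ z → IsIrreducible (recip p z)) (sym eg)
        (recip-IsIrreducible c0 g1 cg' nc0 (subst IsIrreducible eg irg))

    module WithMonicConjugate (d : ℕ) (uh : List ℕ) (nd : d % p ≢ 0) (em : norm p (scale d gs) ≡ uh ++ 1 ∷ [])
        (e : ℕ) (ne : e % p ≢ 0) (ee : scale e (scale d gs) ≈ gs) where
      gh = uh ++ 1 ∷ []
      cgh : Canonical p gh
      cgh = trans (cong (norm p) (sym em)) (trans (norm-idem (scale d gs)) em)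
      gh≈ : gh ≈ scale d gs
      gh≈ = mk (trans (cong (norm p) (sym em)) (norm-idem (scale d gs)))
      gs≈ : gs ≈ scale e gh
      gs≈ = ≈-sym ee ∙ scale-cong {e} {e} refl (≈-sym gh≈)
      sgh : ∥ gh ∥ ≡ ∥ g ∥
      sgh = trans (∥∥-cong gh≈) (trans (∥∥-scale d gs nd) sgs)
      nZgh : ¬ IsZero gh
      nZgh z = nZgs (gs≈ ∙ scale-cong {e} {e} refl z)

      irgh : IsIrreducible gh
      irgh = ≤-trans sg2 (≤-reflexive (sym sgh)) , fac
        where
        fac : ∀ a b → mulRaw a b ≈ gh → ∥ a ∥ ≡ 1 ⊎ ∥ b ∥ ≡ 1
        fac a b ab with proj₂ irgs (scale e a) b (mul-scaleˡ e a b ∙ scale-cong {e} {e} refl ab ∙ ≈-sym gs≈)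
        ... | inj₁ x = inj₁ (trans (sym (∥∥-scale e a ne)) x)
        ... | inj₂ x = inj₂ x

      module Eg = Euclid ug cg irg
      module Eh = Euclid uh cgh irgh

      v = u * e
      nv : v % p ≢ 0
      nv = %-*-nonzero {u} {e} nu ne

      rv : r ≈ scale v (mulRaw g gh)
      rv = r≈ ∙ mul-cong (≈-sym (scale≈mul-constant u g)) (≈-refl {gs}) ∙ mul-scaleˡ u g gs
          ∙ scale-cong {u} {u} refl (mul-cong {g} ≈-refl gs≈ ∙ mul-scaleʳ e g gh)
          ∙ ≡→≈ (scale-scale u e (mulRaw g gh))

      r∣g·gh : r ∣ₚ mulRaw g gh
      r∣g·gh with scale-inverse v (mulRaw g gh) nv
      ... | v' , _ , ev = ∣ₚ-respʳ {r} (scale-cong {v'} {v'} refl rv ∙ ev) (∣ₚ-scale {r} v' (∣ₚ-refl r))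

      -- Otherwise g* would be a constant multiple of g.
      g∤gh : ¬ g ∣ₚ gh
      g∤gh (h , eh) = ncm (e * c' , trans (sym cgs)
          (un (gs≈ ∙ scale-cong {e} {e} refl
          (≈-sym eh ∙ mul-cong {g} ≈-refl ec' ∙ mul-comm g (c' ∷ []) ∙ ≈-sym (scale≈mul-constant c' g))
          ∙ ≡→≈ (scale-scale e c' g))))
        where
        nh : ¬ IsZero h
        nh z = nZgh (≈-sym eh ∙ IsZero-mulʳ g h z)
        sh : ∥ h ∥ ≡ 1
        sh = +-cancelˡ-≡ ∥ g ∥ _ _ (trans (sym (∥∥-mul g h nZg nh))
            (trans (cong suc (trans (∥∥-cong eh) sgh)) (+-comm 1 ∥ g ∥)))
        uf = unit-constant h sh
        c' = proj₁ uf
        ec' : h ≈ c' ∷ []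
        ec' = proj₁ (proj₂ uf)

      g∣⇒g*∣ : ∀ g' → CanonicalSR g' → g ∣ₚ g' → gs ∣ₚ g'
      g∣⇒g*∣ g' (cg' , _ , sg') = ∣ₚ-recip g g' cg cg' sg'
      g*∣⇒g∣ : ∀ g' → CanonicalSR g' → gs ∣ₚ g' → g ∣ₚ g'
      g*∣⇒g∣ g' (cg' , _ , sg') dv = subst (λ z → z ∣ₚ g') rr (∣ₚ-recip gs g' cgs cg' sg' dv)
      g*∣gh : gs ∣ₚ gh
      g*∣gh = ∣ₚ-respʳ {gs} (≈-sym gh≈) (∣ₚ-scale {gs} d (∣ₚ-refl gs))
      gh∣g* : gh ∣ₚ gs
      gh∣g* = ∣ₚ-respʳ {gh} (≈-sym gs≈) (∣ₚ-scale {gh} e (∣ₚ-refl gh))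

      coprime-factors : ∀ g' → g ∣ₚ g' → gh ∣ₚ g' → r ∣ₚ g'
      coprime-factors g' g∣g' (h , eh) with Eg.euclid gh h (∣ₚ-respʳ {g} (≈-sym eh) g∣g')
      ... | inj₁ x = ⊥-elim (g∤gh x)
      ... | inj₂ (h2 , e2) = ∣ₚ-trans {r} r∣g·gh
          (h2 , mul-assoc g gh h2 ∙ mul-cong {g} ≈-refl (mul-comm gh h2) ∙ ≈-sym (mul-assoc g h2 gh)
          ∙ mul-cong e2 (≈-refl {gh}) ∙ mul-comm h gh ∙ eh)

      HasFactor : List ℕ → Set
      HasFactor x = g ∣ₚ x ⊎ gh ∣ₚ x

      -- gh is the monic associate of g*, and a self-reciprocal multiple of g is one of g* too.
      HasFactor-absorbs : ∀ x → HasFactor x → ∀ g' → CanonicalSR g' → 2 ∣ deg g' → x ∣ₚ g' → r ∣ₚ g'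
      HasFactor-absorbs x (inj₁ t) g' sr' _ dx =
          coprime-factors g' dgg' (∣ₚ-trans {gh} gh∣g* (g∣⇒g*∣ g' sr' dgg'))
        where dgg' = ∣ₚ-trans {g} t dx
      HasFactor-absorbs x (inj₂ t) g' sr' _ dx =
          coprime-factors g' (g*∣⇒g∣ g' sr' (∣ₚ-trans {gs} g*∣gh dhg')) dhg'
        where dhg' = ∣ₚ-trans {gh} t dx

      dichotomy : ∀ x → (∀ X → x ∣ₚ mulRaw r X → x ∣ₚ X) ⊎ HasFactor x
      dichotomy x with monic-∣ₚ? ug x cg | monic-∣ₚ? uh x cgh
      ... | yes a | _ = inj₂ (inj₁ a)
      ... | no _ | yes b = inj₂ (inj₂ b)
      ... | no na | no nb = inj₁ (λ X dv → Eh.coprime-cancel x X nb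
          (Eg.coprime-cancel x (mulRaw gh X) na
          (∣ₚ-scale⁻¹ {x} v nv (∣ₚ-respʳ {x}
          (mul-cong rv (≈-refl {X}) ∙ mul-scaleˡ v (mulRaw g gh) X
          ∙ scale-cong {v} {v} refl (mul-assoc g gh X)) dv))))

      r-selfRecip : recip p r ≡ r
      r-selfRecip = canonical-≈⇒≡ (recip-canonical r) cr
        (≡→≈ (cong (recip p) er) ∙ ≡→≈ (recip-mul A gs (norm-idem (mulRaw (u ∷ []) g)) cgs) ∙ norm≈ _ ∙
         mul-cong (≡→≈ (recip-mul (u ∷ []) g cu cg) ∙ norm≈ _
             ∙ mul-cong {recip p (u ∷ [])} {u ∷ []} (≡→≈ cu) (≈-refl {gs})) (≡→≈ rr) ∙
         mul-assoc (u ∷ []) gs g ∙ mul-cong {u ∷ []} ≈-refl (mul-comm gs g)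
             ∙ ≈-sym (mul-assoc (u ∷ []) g gs) ∙ ≈-sym r≈)
        where
        A = norm p (mulRaw (u ∷ []) g)

      posr : 1 ≤ length ur
      posr = ≤-pred (≤-trans sg2 (≤-trans (∣ₚ⇒∥∥≤ g r nZr dgr) (≤-reflexive (∥∥-canonical-snoc ur 1 cr))))
        where
        dgr : g ∣ₚ r
        dgr = mulRaw (u ∷ []) gs , ≈-sym
            (r≈ ∙ mul-cong (mul-comm (u ∷ []) g) (≈-refl {gs}) ∙ mul-assoc g (u ∷ []) gs)

      srPrime : SRPrime ur
      srPrime = mkSRPrime ur cr r-selfRecip evr posr HasFactor dichotomy HasFactor-absorbs

    srPrime : SRPrime ur
    srPrime = from-associate (monic-associate gs nZgs)
      where
      from-associate : (Σ ℕ λ d → Σ (List ℕ) λ uh → d % p ≢ 0 × norm p (scale d gs) ≡ uh ++ 1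
          ∷ []) → SRPrime ur
      from-associate (d , uh , nd , em) = from-inverse (scale-inverse d gs nd)
        where
        from-inverse : (Σ ℕ λ e → e % p ≢ 0 × scale e (scale d gs) ≈ gs) → SRPrime ur
        from-inverse (e , ne , ee) = WithMonicConjugate.srPrime d uh nd em e ne ee

  -- The coefficients of 𝒢

  [p-1]²≡1 : (suc q * suc q) % p ≡ 1
  [p-1]²≡1 = trans (cong (_% p) (sym (cong suc (*-suc q (suc q))))) ([m+kn]%n≡m%n 1 q p)

  ⌊[a+a∸b+b]/2⌋≡a∸b : ∀ a b → b ≤ a → ⌊ (a + a) ∸ (b + b) /2⌋ ≡ a ∸ b
  ⌊[a+a∸b+b]/2⌋≡a∸b a b le = trans
      (cong ⌊_/2⌋ (trans (cong (_∸ (b + b)) (sym ([d+d]+[n∸d+n∸d]≡n+n b a le)))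
      (m+n∸m≡n (b + b) ((a ∸ b) + (a ∸ b))))) (sym (n≡⌊n+n/2⌋ (a ∸ b)))

  deg-snoc : ∀ (ur : List ℕ) → deg (ur ++ 1 ∷ []) ≡ length ur
  deg-snoc ur = trans (cong (_∸ 1) (length-++ ur)) (m+n∸n≡m (length ur) 1)

  N-pow-SRPrime : ∀ ur → SRPrime ur → ∀ k → PrimePowerCoefficients p (ur ++ 1 ∷ []) k
  N-pow-SRPrime ur srPrime k = N-zero , N-at-multiples , N-elsewhere
    where
    open PowersOf ur srPrime
    r-deg : deg r ≡ length ur
    r-deg = deg-snoc ur
    exponents : ∀ j → 1 ≤ j →
      p ^ ⌊ deg (pow p r j) /2⌋ ∸ p ^ ⌊ (deg (pow p r j) ∸ deg r) /2⌋ ≡ p ^ (j * Dh) ∸ p ^ (j * Dh ∸ Dh)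
    exponents j j≥1 = cong₂ (λ x y → p ^ x ∸ p ^ y)
      (trans (cong ⌊_/2⌋ (deg-pow j)) (sym (n≡⌊n+n/2⌋ (j * Dh))))
      (trans (cong ⌊_/2⌋ (cong₂ _∸_ (deg-pow j) (trans r-deg lur)))
             (⌊[a+a∸b+b]/2⌋≡a∸b (j * Dh) Dh (subst (_≤ j * Dh) (*-identityˡ Dh) (*-monoˡ-≤ Dh j≥1))))
    N-at-multiples : ∀ j → 1 ≤ j → j ≤ k →
      IsN p (pow p r k) (j * deg r) (p ^ ⌊ deg (pow p r j) /2⌋ ∸ p ^ ⌊ (deg (pow p r j) ∸ deg r) /2⌋)
    N-at-multiples j j≥1 j≤k =
      subst₂ (IsN p (pow p r k)) (cong (j *_) (sym r-deg)) (sym (exponents j j≥1)) (N-pow k j j≥1 j≤k)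
    N-elsewhere : ∀ t → (∀ j → j ≤ k → t ≢ j * deg r) → IsN p (pow p r k) t 0
    N-elsewhere t t≢ = N-off-lattice k t (λ i i≤k e → t≢ i i≤k (trans e (cong (i *_) (sym r-deg))))

  PrimeSelfRecip⇒SRPrime : ∀ ur → PrimeSelfRecip p (ur ++ 1 ∷ []) → 2 ∣ length ur → SRPrime ur
  PrimeSelfRecip⇒SRPrime ur (cr , _ , inj₁ (irr , (_ , sr))) evr =
    irreducible⇒SRPrime ur cr sr evr (Irreducible⇒IsIrreducible irr)
  PrimeSelfRecip⇒SRPrime ur (cr , _ , inj₂ (g , u , mg , irg , ncm , u0 , uP , er)) evr with
      Monic⇒MonicForm {g} mg
  ... | ug , refl = ConjugatePair.srPrime ug (proj₁ irg) (Irreducible⇒IsIrreducible irg) ncm u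
      u0 uP ur cr er evr

  primeSelfRecip-power-coefficients : ∀ r k → PrimeSelfRecip p r → 2 ∣ deg r → 1 ≤ k →
    PrimePowerCoefficients p r k
  primeSelfRecip-power-coefficients r k r-prime@(_ , mr , _) even _ with Monic⇒MonicForm {r} mr
  ... | ur , refl = N-pow-SRPrime ur (PrimeSelfRecip⇒SRPrime ur r-prime (subst (2 ∣_) (deg-snoc ur) even)) k

  pow-*2 : ∀ f K → pow p f (K * 2) ≡ pow p (pow p f 2) K
  pow-*2 f zero = refl
  pow-*2 f (suc K) = canonical-≈⇒≡ (pow-canonical f (suc K * 2)) (pow-canonical (pow p f 2) (suc K))
    (pow-+ f 2 (K * 2) ∙ mul-cong {pow p f 2} ≈-refl (≡→≈ (pow-*2 f K)) ∙ ≈-sym (pow-suc (pow p f 2) K))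

  linear-power-coefficients : ∀ a0 κ α → (cq : Canonical p (a0 ∷ 1 ∷ [])) → eval α (a0 ∷ 1 ∷ []) ≡ₘ 0 →
    (1 + κ * α) ≡ₘ 0 → (α * α) ≡ₘ 1 → (κ * κ) ≡ₘ 1 → recip p (a0 ∷ 1 ∷ []) ≈ scale κ (a0 ∷ 1 ∷ []) →
    ∀ k → 2 ∣ k → LinearPowerCoefficients p (a0 ∷ 1 ∷ []) k
  linear-power-coefficients a0 κ α cq ℓ[α]≡0 1+κα≡0 α²≡1 κ²≡1 ℓ*≈κℓ .(K * 2) (divides K refl) = N-zero ,
      N-at-evens , N-elsewhere
    where
    open SquareOfLinear a0 κ α cq ℓ[α]≡0 1+κα≡0 α²≡1 κ²≡1 ℓ*≈κℓ
    open PowersOf us srPrime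
    half : ⌊ K * 2 /2⌋ ≡ K
    half = trans (cong ⌊_/2⌋ (n*2≡n+n K)) (sym (n≡⌊n+n/2⌋ K))
    square : pow p (a0 ∷ 1 ∷ []) (K * 2) ≡ pow p (us ++ 1 ∷ []) K
    square = trans (pow-*2 (a0 ∷ 1 ∷ []) K) (cong (λ z → pow p z K) ℓ²≡)
    2j : ∀ j → j * length us ≡ 2 * j
    2j j = trans (cong (j *_) length-us) (*-comm j 2)
    N-at-evens : ∀ j → 1 ≤ j → j ≤ ⌊ K * 2 /2⌋
        → IsN p (pow p (a0 ∷ 1 ∷ []) (K * 2)) (2 * j) (p ^ (j ∸ 1) * (p ∸ 1))
    N-at-evens (suc j) j≥1 j≤K =
      subst₂ (λ f t → IsN p f t (p ^ j * suc q)) (sym square) (2j (suc j))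
        (subst (IsN p (pow p (us ++ 1 ∷ []) K) (suc j * length us)) value
            (N-pow K (suc j) j≥1 (subst (suc j ≤_) half j≤K)))
      where
      value : p ^ (suc j * Dh) ∸ p ^ (suc j * Dh ∸ Dh) ≡ p ^ j * suc q
      value = begin
        p ^ (suc j * 1) ∸ p ^ (suc j * 1 ∸ 1) ≡⟨ cong₂ (λ x y → p ^ x ∸ p ^ y) (*-identityʳ (suc j))
            (cong (_∸ 1) (*-identityʳ (suc j))) ⟩
        p * p ^ j ∸ p ^ j                     ≡⟨ cong₂ _∸_ (*-comm p (p ^ j)) (sym (*-identityʳ (p ^ j))) ⟩
        p ^ j * p ∸ p ^ j * 1                 ≡⟨ sym (*-distribˡ-∸ (p ^ j) p 1) ⟩
        p ^ j * suc q                         ∎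
        where open ≡-Reasoning
    N-elsewhere : ∀ t → (∀ j → j ≤ ⌊ K * 2 /2⌋ → t ≢ 2 * j) → IsN p (pow p (a0 ∷ 1 ∷ []) (K * 2)) t 0
    N-elsewhere t t≢ = subst (λ f → IsN p f t 0) (sym square)
      (N-off-lattice K t (λ i i≤K e → t≢ i (subst (i ≤_) (sym half) i≤K) (trans e (2j i))))

  [x+1]^k-coefficients : ∀ k → 2 ∣ k → LinearPowerCoefficients p (1 ∷ 1 ∷ []) k
  [x+1]^k-coefficients = linear-power-coefficients 1 1 (suc q) refl root [1+κα]≡ₘ0 [p-1]²≡1 refl (mk refl)
    where
    root : eval (suc q) (1 ∷ 1 ∷ []) ≡ₘ 0
    root = trans (cong (λ z → (1 + suc q * (1 + z)) % p) (*-zeroʳ (suc q)))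
                 (trans (cong (λ z → (1 + z) % p) (*-identityʳ (suc q))) (n%n≡0 p))
    [1+κα]≡ₘ0 : (1 + 1 * suc q) ≡ₘ 0
    [1+κα]≡ₘ0 = trans (cong (λ z → (1 + z) % p) (*-identityˡ (suc q))) (n%n≡0 p)

  [x-1]^k-coefficients : ∀ k → 2 ∣ k → LinearPowerCoefficients p (suc q ∷ 1 ∷ []) k
  [x-1]^k-coefficients = linear-power-coefficients (suc q) (suc q) 1 canonical root [1+κα]≡ₘ0
      refl [p-1]²≡1 recip≈-
    where
    canonical : Canonical p (suc q ∷ 1 ∷ [])
    canonical = trans (consT-ne ((suc q) % p) (1 ∷ []) (λ ())) (cong (_∷ 1 ∷ []) (m<n⇒m%n≡m (n<1+n (suc q))))
    root : eval 1 (suc q ∷ 1 ∷ []) ≡ₘ 0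
    root = trans (cong (_% p) (+-comm (suc q) 1)) (n%n≡0 p)
    [1+κα]≡ₘ0 : (1 + suc q * 1) ≡ₘ 0
    [1+κα]≡ₘ0 = trans (cong (λ z → (1 + z) % p) (*-identityʳ (suc q))) (n%n≡0 p)
    recip≈- : recip p (suc q ∷ 1 ∷ []) ≈ scale (suc q) (suc q ∷ 1 ∷ [])
    recip≈- = norm≈ (1 ∷ suc q ∷ []) ∙
      ≈-∷ {1} {suc q * suc q} (sym [p-1]²≡1)
          (≈-∷ {suc q} {suc q * 1} (cong (_% p) (sym (*-identityʳ (suc q)))) ≈-refl)

lemma4 : (p : ℕ) → Prime p →
    ((r : List ℕ) (k : ℕ) → PrimeSelfRecip p r → 2 ∣ deg r → 1 ≤ k →
      IsN p (pow p r k) 0 1 ×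
      (∀ j → 1 ≤ j → j ≤ k →
        IsN p (pow p r k) (j * deg r)
          (p ^ ⌊ deg (pow p r j) /2⌋ ∸ p ^ ⌊ (deg (pow p r j) ∸ deg r) /2⌋)) ×
      (∀ t → (∀ j → j ≤ k → t ≢ j * deg r) → IsN p (pow p r k) t 0))
    ×
    ((k : ℕ) → 2 ∣ k → 1 ≤ k →
      (IsN p (pow p (1 ∷ 1 ∷ []) k) 0 1 ×
       (∀ j → 1 ≤ j → j ≤ ⌊ k /2⌋ →
         IsN p (pow p (1 ∷ 1 ∷ []) k) (2 * j) (p ^ (j ∸ 1) * (p ∸ 1))) ×
       (∀ t → (∀ j → j ≤ ⌊ k /2⌋ → t ≢ 2 * j) → IsN p (pow p (1 ∷ 1 ∷ []) k) t 0))
      ×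
      (IsN p (pow p (p ∸ 1 ∷ 1 ∷ []) k) 0 1 ×
       (∀ j → 1 ≤ j → j ≤ ⌊ k /2⌋ →
         IsN p (pow p (p ∸ 1 ∷ 1 ∷ []) k) (2 * j) (p ^ (j ∸ 1) * (p ∸ 1))) ×
       (∀ t → (∀ j → j ≤ ⌊ k /2⌋ → t ≢ 2 * j) → IsN p (pow p (p ∸ 1 ∷ 1 ∷ []) k) t 0)))
lemma4 zero pr = ⊥-elim (¬prime[0] pr)
lemma4 (suc zero) pr = ⊥-elim (¬prime[1] pr)
lemma4 (suc (suc q)) pr =
  primeSelfRecip-power-coefficients q pr ,
  λ k 2∣k _ → [x+1]^k-coefficients q pr k 2∣k , [x-1]^k-coefficients q pr k 2∣k
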